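{- Let $r\ge s\ge 2$ be integers. Then $${\rm gp_{e}}(P_r \,\square\, P_s) = \begin{cases} r + 2, & s = 2,\\ 2r, & s = 3,\\ 2r + 2s - 8, & s \geq 4. \end{cases}$$
   Context: $P_n$ is the path on $n$ vertices. The Cartesian product $G\,\square\, H$ has vertex set $V(G)\times V(H)$, with $(g,h)$ adjacent to $(g',h')$ iff either $gg'\in E(G)$ and $h=h'$, or $g=g'$ and $hh'\in E(H)$. A geodesic is a shortest path. A set $S$ of edges of a graph $G$ is an edge general position set if no geodesic of $G$ contains three edges of $S$; ${\rm gp_{e}}(G)$ is the maximum cardinality of an edge general position set of $G$. -}

module Defs where

open import Data.Nat using (ℕ; suc; _≤_)
open import Data.Fin using (Fin; toℕ)
open import Data.Product using (_×_; _,_; proj₁; proj₂; Σ; ∃; swap)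
open import Data.Sum using (_⊎_)
open import Data.List using (List; length; lookup)
open import Data.List.Relation.Unary.All using (All)
open import Data.List.Relation.Unary.AllPairs using (AllPairs)
open import Relation.Binary.PropositionalEquality using (_≡_; _≢_)
open import Relation.Nullary using (¬_)

record Graph : Set₁ where
  field
    V   : Set
    Adj : V → V → Set
open Graph public

P : ℕ → Graph
V (P n) = Fin n
Adj (P n) i j = (suc (toℕ i) ≡ toℕ j) ⊎ (suc (toℕ j) ≡ toℕ i)

_□_ : Graph → Graph → Graph
V (G □ H) = V G × V H
Adj (G □ H) (g , h) (g' , h') =
  (Adj G g g' × h ≡ h') ⊎ (g ≡ g' × Adj H h h')

module _ (G : Graph) where

  data Walk : V G → V G → Set where
    [] : ∀ {u} → Walk u u
    _∷_ : ∀ {u w v} → Adj G u w → Walk w v → Walk u v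

  len : ∀ {u v} → Walk u v → ℕ
  len [] = 0
  len (_ ∷ W) = suc (len W)

  Geodesic : ∀ {u v} → Walk u v → Set
  Geodesic {u} {v} W = ∀ (W' : Walk u v) → len W ≤ len W'

  -- An edge is represented by an ordered pair of its end vertices;
  -- two representations denote the same edge iff equal up to swapping.
  Edge : Set
  Edge = V G × V G

  SameEdge : Edge → Edge → Set
  SameEdge e f = (e ≡ f) ⊎ (e ≡ swap f)

  data EdgeOn (e : Edge) : ∀ {u v} → Walk u v → Set where
    here  : ∀ {u w v} (a : Adj G u w) (W : Walk w v) →
            SameEdge e (u , w) → EdgeOn e (a ∷ W)
    there : ∀ {u w v} (a : Adj G u w) {W : Walk w v} →
            EdgeOn e W → EdgeOn e (a ∷ W)

  IsEdgeSet : List Edge → Set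
  IsEdgeSet S = All (λ e → Adj G (proj₁ e) (proj₂ e)) S
              × AllPairs (λ e f → ¬ SameEdge e f) S

  IsEdgeGP : List Edge → Set
  IsEdgeGP S = ∀ {u v} (W : Walk u v) → Geodesic W →
    ∀ (i j k : Fin (length S)) → i ≢ j → j ≢ k → i ≢ k →
    ¬ (EdgeOn (lookup S i) W × EdgeOn (lookup S j) W × EdgeOn (lookup S k) W)

  gpe≡ : ℕ → Set
  gpe≡ k = (Σ (List Edge) λ S → IsEdgeSet S × IsEdgeGP S × length S ≡ k)
         × (∀ (S : List Edge) → IsEdgeSet S → IsEdgeGP S → length S ≤ k)

{-# OPTIONS --safe #-}
-- A walk in P r □ P s projects onto walks in the two factors, so it is at least as long as ∣Δx∣ + ∣Δy∣, with
-- equality for three-leg staircase walks; hence a geodesic never turns back in either coordinate.  It therefore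
-- crosses each cut between consecutive columns (or rows) at most once, and once it has met the first and the last
-- column in interior rows, every vertex between them lies in an interior row as well.  This shows that the
-- following sets meet every geodesic in at most two edges: for s = 2 the r rungs and the two edges between the
-- first two columns; for s = 3 the two row cuts; for s ≥ 4 the interior edges of the four boundary cuts.  For the
-- upper bounds, a geodesic carries at most two edges of an edge general position set, so double counting against
-- a family of staircase geodesics covering every edge twice bounds the set by the size of the family.  For s = 2
-- the count is weighted instead: a rail lies on r of the 2 r column geodesics, a rung on two of them, and there
-- are only r rungs.
module Submission where

open import Defs
open import Data.Nat using (ℕ; zero; suc; _+_; _*_; _∸_; _≤_; _<_; _≥_; _⊓_; _⊔_; ∣_-_∣; z≤n; s≤s; s≤s⁻¹; _≤?_)
open import Data.Nat.Properties
open import Algebra.Properties.CommutativeSemigroup +-commutativeSemigroup using () renaming (interchange to +-interchange)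
open import Data.Nat.ListAction using (sum)
open import Data.Nat.ListAction.Properties using (sum-++)
open import Data.Nat.Solver using (module +-*-Solver)
open import Data.Fin using (Fin; toℕ; fromℕ; fromℕ<; inject₁) renaming (zero to fzero; suc to fsuc; _<_ to _<ᶠ_)
open import Data.Fin.Properties
  using (toℕ-injective; toℕ-fromℕ<; toℕ-fromℕ; toℕ<n; toℕ≤pred[n]; toℕ-inject₁; inject₁-injective; pigeonhole)
  renaming (_≟_ to _≟ᶠ_; <-cmp to <-cmpᶠ; <⇒≢ to <⇒≢ᶠ; suc-injective to fsuc-injective)
open import Data.Fin.Relation.Unary.Top using (view; ‵fromℕ; ‵inj₁)
open import Data.Product using (_×_; _,_; proj₁; proj₂; ∃; ∃₂)
open import Data.Product.Properties using (≡-dec)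
open import Data.Sum using (_⊎_; inj₁; inj₂) renaming (swap to ⊎-swap)
open import Data.Unit using (⊤; tt)
open import Data.Empty using (⊥; ⊥-elim)
open import Data.List using (List; []; _∷_; _++_; map; length; lookup; tabulate; allFin; concatMap; filter)
open import Data.List.Properties using (map-++; length-++; length-tabulate)
open import Data.List.Membership.Propositional using (_∈_)
open import Data.List.Membership.Propositional.Properties using (∈-allFin; ∈-lookup; ∈-tabulate⁺)
open import Data.List.Relation.Unary.All as All using (All; []; _∷_)
import Data.List.Relation.Unary.All.Properties as All
open import Data.List.Relation.Unary.AllPairs using (AllPairs; []; _∷_)
import Data.List.Relation.Unary.AllPairs.Properties as AllPairs
open import Data.List.Relation.Unary.Any using (here; there)
open import Function using (_∘_)
open import Relation.Nullary using (¬_; Dec; yes; no; ¬?)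
open import Relation.Nullary.Decidable using (_⊎-dec_)
open import Relation.Binary using (DecidableEquality; _Preserves_⟶_; tri<; tri≈; tri>)
open import Relation.Binary.PropositionalEquality

-- Walks

module _ {G : Graph} where

  infixr 5 _++ᵂ_
  _++ᵂ_ : ∀ {u w v} → Walk G u w → Walk G w v → Walk G u v
  []      ++ᵂ W′ = W′
  (a ∷ W) ++ᵂ W′ = a ∷ (W ++ᵂ W′)

  len-++ᵂ : ∀ {u w v} (W : Walk G u w) (W′ : Walk G w v) → len G (W ++ᵂ W′) ≡ len G W + len G W′
  len-++ᵂ []      W′ = refl
  len-++ᵂ (a ∷ W) W′ = cong suc (len-++ᵂ W W′)

  EdgeOn-++ˡ : ∀ {e u w v} {W : Walk G u w} (W′ : Walk G w v) → EdgeOn G e W → EdgeOn G e (W ++ᵂ W′)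
  EdgeOn-++ˡ W′ (here a W p) = here a (W ++ᵂ W′) p
  EdgeOn-++ˡ W′ (there a p)  = there a (EdgeOn-++ˡ W′ p)

  EdgeOn-++ʳ : ∀ {e u w v} (W : Walk G u w) {W′ : Walk G w v} → EdgeOn G e W′ → EdgeOn G e (W ++ᵂ W′)
  EdgeOn-++ʳ []      p = p
  EdgeOn-++ʳ (a ∷ W) p = there a (EdgeOn-++ʳ W p)

  SameEdge-sym : ∀ {e f} → SameEdge G e f → SameEdge G f e
  SameEdge-sym (inj₁ refl) = inj₁ refl
  SameEdge-sym (inj₂ refl) = inj₂ refl

  SameEdge-trans : ∀ {e f g} → SameEdge G e f → SameEdge G f g → SameEdge G e g
  SameEdge-trans (inj₁ refl) q           = q
  SameEdge-trans (inj₂ refl) (inj₁ refl) = inj₂ refl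
  SameEdge-trans (inj₂ refl) (inj₂ refl) = inj₁ refl

  EdgeOn-resp : ∀ {e f u v} {W : Walk G u v} → SameEdge G e f → EdgeOn G e W → EdgeOn G f W
  EdgeOn-resp s (here a W p) = here a W (SameEdge-trans (SameEdge-sym s) p)
  EdgeOn-resp s (there a p)  = there a (EdgeOn-resp s p)

  -- Positions past the end of the walk all denote its last vertex.
  vertexAt : ∀ {u v} → Walk G u v → ℕ → V G
  vertexAt {u} W       zero    = u
  vertexAt {u} []      (suc k) = u
  vertexAt     (a ∷ W) (suc k) = vertexAt W k

  EdgeOn⇒consecutive : ∀ {e u v} (W : Walk G u v) → EdgeOn G e W →
                       ∃ λ k → SameEdge G e (vertexAt W k , vertexAt W (suc k))
  EdgeOn⇒consecutive (a ∷ [])      (here .a .[] p)      = zero , p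
  EdgeOn⇒consecutive (a ∷ (b ∷ W)) (here .a .(b ∷ W) p) = zero , p
  EdgeOn⇒consecutive (a ∷ W)       (there .a p)         =
    let k , q = EdgeOn⇒consecutive W p in suc k , q

  EdgeOn⇒visits : ∀ {e u v} (W : Walk G u v) → EdgeOn G e W →
                  ∃₂ λ i j → vertexAt W i ≡ proj₁ e × vertexAt W j ≡ proj₂ e
  EdgeOn⇒visits W p with EdgeOn⇒consecutive W p
  ... | k , inj₁ refl = k , suc k , refl , refl
  ... | k , inj₂ refl = suc k , k , refl , refl

  Steps : (V G → V G → Set) → ∀ {u v} → Walk G u v → Set
  Steps R []                = ⊤
  Steps R (_∷_ {u} {w} _ W) = R u w × Steps R W

  Steps-chain : ∀ {R : V G → V G → Set} → (∀ {a} → R a a) → (∀ {a b c} → R a b → R b c → R a c) →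
                ∀ {u v} (W : Walk G u v) → Steps R W → ∀ {i j} → i ≤ j → R (vertexAt W i) (vertexAt W j)
  Steps-chain refl′ trans′ []      _        {zero}  {zero}  _         = refl′
  Steps-chain refl′ trans′ []      _        {zero}  {suc j} _         = refl′
  Steps-chain refl′ trans′ []      _        {suc i} {suc j} _         = refl′
  Steps-chain refl′ trans′ (a ∷ W) _        {zero}  {zero}  _         = refl′
  Steps-chain refl′ trans′ (a ∷ W) (r , rs) {zero}  {suc j} _         =
    trans′ r (Steps-chain refl′ trans′ W rs {zero} {j} z≤n)
  Steps-chain refl′ trans′ (a ∷ W) (_ , rs) {suc i} {suc j} (s≤s i≤j) = Steps-chain refl′ trans′ W rs i≤j

module _ {G H : Graph} (f : V G → V H) (f-adj : ∀ {a b} → Adj G a b → Adj H (f a) (f b)) where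

  mapᵂ : ∀ {u v} → Walk G u v → Walk H (f u) (f v)
  mapᵂ []      = []
  mapᵂ (a ∷ W) = f-adj a ∷ mapᵂ W

  len-mapᵂ : ∀ {u v} (W : Walk G u v) → len H (mapᵂ W) ≡ len G W
  len-mapᵂ []      = refl
  len-mapᵂ (a ∷ W) = cong suc (len-mapᵂ W)

  EdgeOn-mapᵂ : ∀ {p q u v} {W : Walk G u v} → EdgeOn G (p , q) W → EdgeOn H (f p , f q) (mapᵂ W)
  EdgeOn-mapᵂ (here a W (inj₁ refl)) = here _ _ (inj₁ refl)
  EdgeOn-mapᵂ (here a W (inj₂ refl)) = here _ _ (inj₂ refl)
  EdgeOn-mapᵂ (there a p)            = there _ (EdgeOn-mapᵂ p)

module _ {G : Graph} (adj-sym : ∀ {a b} → Adj G a b → Adj G b a) where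

  reverseᵂ : ∀ {u v} → Walk G u v → Walk G v u
  reverseᵂ []      = []
  reverseᵂ (a ∷ W) = reverseᵂ W ++ᵂ (adj-sym a ∷ [])

  len-reverseᵂ : ∀ {u v} (W : Walk G u v) → len G (reverseᵂ W) ≡ len G W
  len-reverseᵂ []      = refl
  len-reverseᵂ (a ∷ W) = begin
    len G (reverseᵂ W ++ᵂ (adj-sym a ∷ [])) ≡⟨ len-++ᵂ (reverseᵂ W) _ ⟩
    len G (reverseᵂ W) + 1                  ≡⟨ +-comm _ 1 ⟩
    suc (len G (reverseᵂ W))                ≡⟨ cong suc (len-reverseᵂ W) ⟩
    suc (len G W)                           ∎
    where open ≡-Reasoning

  EdgeOn-reverseᵂ : ∀ {e u v} (W : Walk G u v) → EdgeOn G e W → EdgeOn G e (reverseᵂ W)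
  EdgeOn-reverseᵂ (a ∷ W) (here .a .W p) =
    EdgeOn-++ʳ (reverseᵂ W) (here (adj-sym a) [] (SameEdge-trans {G = G} p (inj₂ refl)))
  EdgeOn-reverseᵂ (a ∷ W) (there .a p)   = EdgeOn-++ˡ _ (EdgeOn-reverseᵂ W p)

-- Walks in a path

∣m-n∣≤o+p : ∀ m n o p → n + p ≡ m + o → ∣ m - n ∣ ≤ o + p
∣m-n∣≤o+p m n o p eq = begin
  ∣ m - n ∣                     ≤⟨ ∣-∣-triangle m (m + o) n ⟩
  ∣ m - m + o ∣ + ∣ m + o - n ∣ ≡⟨ cong₂ _+_ (∣m-m+n∣≡n m o) (cong ∣_- n ∣ (sym eq)) ⟩
  o + ∣ n + p - n ∣             ≡⟨ cong (o +_) (trans (∣-∣-comm (n + p) n) (∣m-m+n∣≡n n p)) ⟩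
  o + p                         ∎
  where open ≤-Reasoning

o+p≤∣m-n∣⇒o≡0⊎p≡0 : ∀ m n o p → n + p ≡ m + o → o + p ≤ ∣ m - n ∣ → o ≡ 0 ⊎ p ≡ 0
o+p≤∣m-n∣⇒o≡0⊎p≡0 m n zero    p       _  _ = inj₁ refl
o+p≤∣m-n∣⇒o≡0⊎p≡0 m n (suc o) zero    _  _ = inj₂ refl
o+p≤∣m-n∣⇒o≡0⊎p≡0 m n (suc o) (suc p) eq le = ⊥-elim (<-irrefl refl (begin-strict
  ∣ m - n ∣     ≤⟨ ∣m-n∣≤o+p m n o p (suc-injective (trans (sym (+-suc n p)) (trans eq (+-suc m o)))) ⟩
  o + p         <⟨ s≤s (+-monoʳ-≤ o (n≤1+n p)) ⟩
  suc o + suc p ≤⟨ le ⟩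
  ∣ m - n ∣     ∎))
  where open ≤-Reasoning

P-sym : ∀ {n} {a b : Fin n} → Adj (P n) a b → Adj (P n) b a
P-sym = ⊎-swap

module _ {n : ℕ} where

  ascent : ∀ k (a b : Fin n) → k + toℕ a ≡ toℕ b → Walk (P n) a b
  ascent zero    a b eq with toℕ-injective {i = a} {j = b} eq
  ... | refl = []
  ascent (suc k) a b eq = inj₁ (sym (toℕ-fromℕ< a<n)) ∷ ascent k (fromℕ< a<n) b eq′
    where
    a<n : suc (toℕ a) < n
    a<n = ≤-<-trans (≤-trans (s≤s (m≤n+m (toℕ a) k)) (≤-reflexive eq)) (toℕ<n b)
    eq′ : k + toℕ (fromℕ< a<n) ≡ toℕ b
    eq′ = trans (cong (k +_) (toℕ-fromℕ< a<n)) (trans (+-suc k (toℕ a)) eq)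

  len-ascent : ∀ k (a b : Fin n) eq → len (P n) (ascent k a b eq) ≡ k
  len-ascent zero    a b eq with toℕ-injective {i = a} {j = b} eq
  ... | refl = refl
  len-ascent (suc k) a b eq = cong suc (len-ascent k _ b _)

  EdgeOn-ascent : ∀ k (a b : Fin n) eq {p q : Fin n} → suc (toℕ p) ≡ toℕ q →
                  toℕ a ≤ toℕ p → toℕ q ≤ toℕ b → EdgeOn (P n) (p , q) (ascent k a b eq)
  EdgeOn-ascent zero    a b eq pq a≤p q≤b with toℕ-injective {i = a} {j = b} eq
  ... | refl = ⊥-elim (<-irrefl refl (≤-trans (s≤s a≤p) (≤-trans (≤-reflexive pq) q≤b)))
  EdgeOn-ascent (suc k) a b eq {p} {q} pq a≤p q≤b with toℕ a ≟ toℕ p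
  ... | yes a≡p = here _ _ (inj₁ (cong₂ _,_ (toℕ-injective (sym a≡p))
                    (toℕ-injective (trans (sym pq) (trans (cong suc (sym a≡p)) (sym (toℕ-fromℕ< _)))))))
  ... | no  a≢p = there _ (EdgeOn-ascent k _ b _ pq (≤-trans (≤-reflexive (toℕ-fromℕ< _)) (≤∧≢⇒< a≤p a≢p)) q≤b)

  segment : (a b : Fin n) → Walk (P n) a b
  segment a b with ≤-total (toℕ a) (toℕ b)
  ... | inj₁ a≤b = ascent (toℕ b ∸ toℕ a) a b (m∸n+n≡m a≤b)
  ... | inj₂ b≤a = reverseᵂ P-sym (ascent (toℕ a ∸ toℕ b) b a (m∸n+n≡m b≤a))

  len-segment : (a b : Fin n) → len (P n) (segment a b) ≡ ∣ toℕ a - toℕ b ∣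
  len-segment a b with ≤-total (toℕ a) (toℕ b)
  ... | inj₁ a≤b = trans (len-ascent (toℕ b ∸ toℕ a) a b (m∸n+n≡m a≤b)) (sym (m≤n⇒∣m-n∣≡n∸m a≤b))
  ... | inj₂ b≤a = trans (len-reverseᵂ P-sym (ascent (toℕ a ∸ toℕ b) b a (m∸n+n≡m b≤a)))
                     (trans (len-ascent (toℕ a ∸ toℕ b) b a (m∸n+n≡m b≤a)) (sym (m≤n⇒∣n-m∣≡n∸m b≤a)))

  EdgeOn-segment : (a b : Fin n) {p q : Fin n} → suc (toℕ p) ≡ toℕ q →
                   toℕ a ⊓ toℕ b ≤ toℕ p → toℕ q ≤ toℕ a ⊔ toℕ b → EdgeOn (P n) (p , q) (segment a b)
  EdgeOn-segment a b {p} {q} pq lo hi with ≤-total (toℕ a) (toℕ b)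
  ... | inj₁ a≤b = EdgeOn-ascent (toℕ b ∸ toℕ a) a b (m∸n+n≡m a≤b) pq
                     (subst (_≤ toℕ p) (m≤n⇒m⊓n≡m a≤b) lo) (subst (toℕ q ≤_) (m≤n⇒m⊔n≡n a≤b) hi)
  ... | inj₂ b≤a = EdgeOn-reverseᵂ P-sym (ascent (toℕ a ∸ toℕ b) b a (m∸n+n≡m b≤a))
                     (EdgeOn-ascent (toℕ a ∸ toℕ b) b a (m∸n+n≡m b≤a) pq
                        (subst (_≤ toℕ p) (m≥n⇒m⊓n≡n b≤a) lo) (subst (toℕ q ≤_) (m≥n⇒m⊔n≡m b≤a) hi))

  ups downs : ∀ {a b : Fin n} → Walk (P n) a b → ℕ
  ups []           = 0
  ups (inj₁ _ ∷ W) = suc (ups W)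
  ups (inj₂ _ ∷ W) = ups W
  downs []           = 0
  downs (inj₁ _ ∷ W) = downs W
  downs (inj₂ _ ∷ W) = suc (downs W)

  len≡ups+downs : ∀ {a b : Fin n} (W : Walk (P n) a b) → len (P n) W ≡ ups W + downs W
  len≡ups+downs []           = refl
  len≡ups+downs (inj₁ _ ∷ W) = cong suc (len≡ups+downs W)
  len≡ups+downs (inj₂ _ ∷ W) = trans (cong suc (len≡ups+downs W)) (sym (+-suc (ups W) (downs W)))

  displacement : ∀ {a b : Fin n} (W : Walk (P n) a b) → toℕ b + downs W ≡ toℕ a + ups W
  displacement []                   = refl
  displacement {a} (inj₁ e ∷ W)     = trans (displacement W) (trans (cong (_+ ups W) (sym e)) (sym (+-suc (toℕ a) (ups W))))
  displacement {a} {b} (inj₂ e ∷ W) = trans (+-suc (toℕ b) (downs W)) (trans (cong suc (displacement W)) (cong (_+ ups W) e))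

  ∣-∣≤len : ∀ {a b : Fin n} (W : Walk (P n) a b) → ∣ toℕ a - toℕ b ∣ ≤ len (P n) W
  ∣-∣≤len {a} {b} W = subst (∣ toℕ a - toℕ b ∣ ≤_) (sym (len≡ups+downs W))
    (∣m-n∣≤o+p (toℕ a) (toℕ b) (ups W) (downs W) (displacement W))

  len≤∣-∣⇒one-way : ∀ {a b : Fin n} (W : Walk (P n) a b) → len (P n) W ≤ ∣ toℕ a - toℕ b ∣ → ups W ≡ 0 ⊎ downs W ≡ 0
  len≤∣-∣⇒one-way {a} {b} W le = o+p≤∣m-n∣⇒o≡0⊎p≡0 (toℕ a) (toℕ b) (ups W) (downs W) (displacement W)
    (subst (_≤ ∣ toℕ a - toℕ b ∣) (len≡ups+downs W) le)

  downs≡0⇒ascending : ∀ {a b : Fin n} (W : Walk (P n) a b) → downs W ≡ 0 → Steps (λ x y → toℕ x ≤ toℕ y) W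
  downs≡0⇒ascending []           _  = tt
  downs≡0⇒ascending (inj₁ e ∷ W) d≡0 = ≤-trans (n≤1+n _) (≤-reflexive e) , downs≡0⇒ascending W d≡0

  ups≡0⇒descending : ∀ {a b : Fin n} (W : Walk (P n) a b) → ups W ≡ 0 → Steps (λ x y → toℕ y ≤ toℕ x) W
  ups≡0⇒descending []           _  = tt
  ups≡0⇒descending (inj₂ e ∷ W) u≡0 = ≤-trans (n≤1+n _) (≤-reflexive e) , ups≡0⇒descending W u≡0

-- Betweenness and monotone sequences

Between : ℕ → ℕ → ℕ → Set
Between a b c = (a ≤ b × b ≤ c) ⊎ (c ≤ b × b ≤ a)

∸-chain : ∀ {a b c} → a ≤ b → b ≤ c → (b ∸ a) + (c ∸ b) ≡ c ∸ a
∸-chain {a} {b} {c} a≤b b≤c = begin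
  (b ∸ a) + (c ∸ b)           ≡⟨ m+n∸m≡n a _ ⟨
  a + ((b ∸ a) + (c ∸ b)) ∸ a ≡⟨ cong (_∸ a) (trans (sym (+-assoc a _ _)) (cong (_+ (c ∸ b)) (m+[n∸m]≡n a≤b))) ⟩
  b + (c ∸ b) ∸ a             ≡⟨ cong (_∸ a) (m+[n∸m]≡n b≤c) ⟩
  c ∸ a                       ∎
  where open ≡-Reasoning

Between⇒∣-∣-additive : ∀ {a b c} → Between a b c → ∣ a - b ∣ + ∣ b - c ∣ ≡ ∣ a - c ∣
Between⇒∣-∣-additive {a} {b} {c} (inj₁ (a≤b , b≤c)) = begin
  ∣ a - b ∣ + ∣ b - c ∣ ≡⟨ cong₂ _+_ (m≤n⇒∣m-n∣≡n∸m a≤b) (m≤n⇒∣m-n∣≡n∸m b≤c) ⟩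
  (b ∸ a) + (c ∸ b)     ≡⟨ ∸-chain a≤b b≤c ⟩
  c ∸ a                 ≡⟨ m≤n⇒∣m-n∣≡n∸m (≤-trans a≤b b≤c) ⟨
  ∣ a - c ∣             ∎
  where open ≡-Reasoning
Between⇒∣-∣-additive {a} {b} {c} (inj₂ (c≤b , b≤a)) = begin
  ∣ a - b ∣ + ∣ b - c ∣ ≡⟨ cong₂ _+_ (m≤n⇒∣n-m∣≡n∸m b≤a) (m≤n⇒∣n-m∣≡n∸m c≤b) ⟩
  (a ∸ b) + (b ∸ c)     ≡⟨ +-comm (a ∸ b) _ ⟩
  (b ∸ c) + (a ∸ b)     ≡⟨ ∸-chain c≤b b≤a ⟩
  a ∸ c                 ≡⟨ m≤n⇒∣n-m∣≡n∸m (≤-trans c≤b b≤a) ⟨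
  ∣ a - c ∣             ∎
  where open ≡-Reasoning

Between-refl : ∀ a c → Between a a c
Between-refl a c with ≤-total a c
... | inj₁ a≤c = inj₁ (≤-refl , a≤c)
... | inj₂ c≤a = inj₂ (c≤a , ≤-refl)

Between-bounded : ∀ {lo hi a b c} → Between a b c → lo ≤ a → a ≤ hi → lo ≤ c → c ≤ hi → lo ≤ b × b ≤ hi
Between-bounded (inj₁ (a≤b , b≤c)) lo≤a _ _ c≤hi = ≤-trans lo≤a a≤b , ≤-trans b≤c c≤hi
Between-bounded (inj₂ (c≤b , b≤a)) _ a≤hi lo≤c _ = ≤-trans lo≤c c≤b , ≤-trans b≤a a≤hi

Monotone : (ℕ → ℕ) → Set
Monotone f = (f Preserves _≤_ ⟶ _≤_) ⊎ (f Preserves _≤_ ⟶ _≥_)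

Straddles : ℕ → ℕ → ℕ → Set
Straddles c a b = (a ≡ c × b ≡ suc c) ⊎ (a ≡ suc c × b ≡ c)

module _ {f : ℕ → ℕ} {c : ℕ} where

  private
    1+c≰c : suc c ≤ c → ⊥
    1+c≰c = <-irrefl refl

    straddles-twice-↑ : f Preserves _≤_ ⟶ _≤_ → ∀ {i j} → i < j →
                        Straddles c (f i) (f (suc i)) → Straddles c (f j) (f (suc j)) → ⊥
    straddles-twice-↑ mono {i}     i<j (inj₂ (fi , fi′)) _                 = 1+c≰c (subst₂ _≤_ fi fi′ (mono (n≤1+n i)))
    straddles-twice-↑ mono         i<j (inj₁ (_ , fi′))  (inj₁ (fj , _))   = 1+c≰c (subst₂ _≤_ fi′ fj (mono i<j))
    straddles-twice-↑ mono {j = j} i<j (inj₁ _)          (inj₂ (fj , fj′)) = 1+c≰c (subst₂ _≤_ fj fj′ (mono (n≤1+n j)))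

    straddles-twice-↓ : f Preserves _≤_ ⟶ _≥_ → ∀ {i j} → i < j →
                        Straddles c (f i) (f (suc i)) → Straddles c (f j) (f (suc j)) → ⊥
    straddles-twice-↓ mono {i}     i<j (inj₁ (fi , fi′)) _                 = 1+c≰c (subst₂ _≤_ fi′ fi (mono (n≤1+n i)))
    straddles-twice-↓ mono         i<j (inj₂ (_ , fi′))  (inj₂ (fj , _))   = 1+c≰c (subst₂ _≤_ fj fi′ (mono i<j))
    straddles-twice-↓ mono {j = j} i<j (inj₂ _)          (inj₁ (fj , fj′)) = 1+c≰c (subst₂ _≤_ fj′ fj (mono (n≤1+n j)))

    straddles-twice : Monotone f → ∀ {i j} → i < j →
                      Straddles c (f i) (f (suc i)) → Straddles c (f j) (f (suc j)) → ⊥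
    straddles-twice (inj₁ mono) = straddles-twice-↑ mono
    straddles-twice (inj₂ mono) = straddles-twice-↓ mono

  Monotone-straddles-once : Monotone f → ∀ {i j} →
                            Straddles c (f i) (f (suc i)) → Straddles c (f j) (f (suc j)) → i ≡ j
  Monotone-straddles-once mono {i} {j} si sj with <-cmp i j
  ... | tri< i<j _ _ = ⊥-elim (straddles-twice mono i<j si sj)
  ... | tri≈ _ i≡j _ = i≡j
  ... | tri> _ _ j<i = ⊥-elim (straddles-twice mono j<i sj si)

Monotone-<-Between : ∀ {f} → Monotone f → ∀ {i j k} → f i < f j → f j < f k → Between i j k
Monotone-<-Between {f} (inj₁ mono) fi<fj fj<fk = inj₁ (reflect fi<fj , reflect fj<fk)
  where
  reflect : ∀ {i j} → f i < f j → i ≤ j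
  reflect {i} {j} fi<fj with ≤-total i j
  ... | inj₁ i≤j = i≤j
  ... | inj₂ j≤i = ⊥-elim (<⇒≱ fi<fj (mono j≤i))
Monotone-<-Between {f} (inj₂ mono) fi<fj fj<fk = inj₂ (reflect fj<fk , reflect fi<fj)
  where
  reflect : ∀ {i j} → f i < f j → j ≤ i
  reflect {i} {j} fi<fj with ≤-total j i
  ... | inj₁ j≤i = j≤i
  ... | inj₂ i≤j = ⊥-elim (<⇒≱ fi<fj (mono i≤j))

Monotone-Between : ∀ {g} → Monotone g → ∀ {i j k} → Between i j k → Between (g i) (g j) (g k)
Monotone-Between (inj₁ mono) (inj₁ (i≤j , j≤k)) = inj₁ (mono i≤j , mono j≤k)
Monotone-Between (inj₁ mono) (inj₂ (k≤j , j≤i)) = inj₂ (mono k≤j , mono j≤i)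
Monotone-Between (inj₂ mono) (inj₁ (i≤j , j≤k)) = inj₂ (mono j≤k , mono i≤j)
Monotone-Between (inj₂ mono) (inj₂ (k≤j , j≤i)) = inj₁ (mono j≤i , mono k≤j)

-- Geodesics in grids

Grid : ℕ → ℕ → Graph
Grid r s = P r □ P s

module _ {r s : ℕ} where

  private
    G : Graph
    G = Grid r s

  X Y : Fin r × Fin s → ℕ
  X v = toℕ (proj₁ v)
  Y v = toℕ (proj₂ v)

  dist : Fin r × Fin s → Fin r × Fin s → ℕ
  dist u v = ∣ X u - X v ∣ + ∣ Y u - Y v ∣

  horizontal : ∀ {a b : Fin r} (y : Fin s) → Walk (P r) a b → Walk G (a , y) (b , y)
  horizontal y = mapᵂ (_, y) (λ a → inj₁ (a , refl))

  vertical : ∀ {a b : Fin s} (x : Fin r) → Walk (P s) a b → Walk G (x , a) (x , b)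
  vertical x = mapᵂ (x ,_) (λ a → inj₂ (refl , a))

  πˣ : ∀ {u v} → Walk G u v → Walk (P r) (proj₁ u) (proj₁ v)
  πˣ []                   = []
  πˣ (inj₁ (a , _) ∷ W)    = a ∷ πˣ W
  πˣ (inj₂ (refl , _) ∷ W) = πˣ W

  πʸ : ∀ {u v} → Walk G u v → Walk (P s) (proj₂ u) (proj₂ v)
  πʸ []                   = []
  πʸ (inj₁ (_ , refl) ∷ W) = πʸ W
  πʸ (inj₂ (_ , a) ∷ W)    = a ∷ πʸ W

  len≡len-πˣ+len-πʸ : ∀ {u v} (W : Walk G u v) → len G W ≡ len (P r) (πˣ W) + len (P s) (πʸ W)
  len≡len-πˣ+len-πʸ []                   = refl
  len≡len-πˣ+len-πʸ (inj₁ (_ , refl) ∷ W) = cong suc (len≡len-πˣ+len-πʸ W)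
  len≡len-πˣ+len-πʸ (inj₂ (refl , _) ∷ W) =
    trans (cong suc (len≡len-πˣ+len-πʸ W)) (sym (+-suc (len (P r) (πˣ W)) _))

  dist≤len : ∀ {u v} (W : Walk G u v) → dist u v ≤ len G W
  dist≤len W = subst (_ ≤_) (sym (len≡len-πˣ+len-πʸ W)) (+-mono-≤ (∣-∣≤len (πˣ W)) (∣-∣≤len (πʸ W)))

  len≡dist⇒Geodesic : ∀ {u v} (W : Walk G u v) → len G W ≡ dist u v → Geodesic G W
  len≡dist⇒Geodesic W eq W′ = ≤-trans (≤-reflexive eq) (dist≤len W′)

  Steps-πˣ : ∀ {R : Fin r → Fin r → Set} → (∀ {a} → R a a) → ∀ {u v} (W : Walk G u v) →
             Steps R (πˣ W) → Steps (λ u v → R (proj₁ u) (proj₁ v)) W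
  Steps-πˣ refl′ []                    _        = tt
  Steps-πˣ refl′ (inj₁ (_ , refl) ∷ W) (r , rs) = r , Steps-πˣ refl′ W rs
  Steps-πˣ refl′ (inj₂ (refl , _) ∷ W) rs       = refl′ , Steps-πˣ refl′ W rs

  Steps-πʸ : ∀ {R : Fin s → Fin s → Set} → (∀ {a} → R a a) → ∀ {u v} (W : Walk G u v) →
             Steps R (πʸ W) → Steps (λ u v → R (proj₂ u) (proj₂ v)) W
  Steps-πʸ refl′ []                    _        = tt
  Steps-πʸ refl′ (inj₁ (_ , refl) ∷ W) rs       = refl′ , Steps-πʸ refl′ W rs
  Steps-πʸ refl′ (inj₂ (refl , _) ∷ W) (r , rs) = r , Steps-πʸ refl′ W rs

  hvh : (a b c : Fin r) (y₁ y₂ : Fin s) → Walk G (a , y₁) (c , y₂)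
  hvh a b c y₁ y₂ = horizontal y₁ (segment a b) ++ᵂ vertical b (segment y₁ y₂) ++ᵂ horizontal y₂ (segment b c)

  vhv : (x₁ x₂ : Fin r) (a b c : Fin s) → Walk G (x₁ , a) (x₂ , c)
  vhv x₁ x₂ a b c = vertical x₁ (segment a b) ++ᵂ horizontal b (segment x₁ x₂) ++ᵂ vertical x₂ (segment b c)

  private
    len-horizontal : (y : Fin s) (a b : Fin r) → len G (horizontal y (segment a b)) ≡ ∣ toℕ a - toℕ b ∣
    len-horizontal y a b = trans (len-mapᵂ (_, y) (λ e → inj₁ (e , refl)) (segment a b)) (len-segment a b)

    len-vertical : (x : Fin r) (a b : Fin s) → len G (vertical x (segment a b)) ≡ ∣ toℕ a - toℕ b ∣
    len-vertical x a b = trans (len-mapᵂ (x ,_) (λ e → inj₂ (refl , e)) (segment a b)) (len-segment a b)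

    len-legs : ∀ {u w w′ v} (W₁ : Walk G u w) (W₂ : Walk G w w′) (W₃ : Walk G w′ v) →
               len G (W₁ ++ᵂ W₂ ++ᵂ W₃) ≡ len G W₁ + len G W₂ + len G W₃
    len-legs W₁ W₂ W₃ = trans (len-++ᵂ W₁ _) (trans (cong (len G W₁ +_) (len-++ᵂ W₂ W₃)) (sym (+-assoc (len G W₁) _ _)))

  len-hvh : ∀ {a b c : Fin r} {y₁ y₂ : Fin s} → Between (toℕ a) (toℕ b) (toℕ c) →
            len G (hvh a b c y₁ y₂) ≡ dist (a , y₁) (c , y₂)
  len-hvh {a} {b} {c} {y₁} {y₂} abc = begin
    len G (hvh a b c y₁ y₂)  ≡⟨ len-legs (horizontal y₁ (segment a b)) _ _ ⟩
    len G (horizontal y₁ (segment a b)) + len G (vertical b (segment y₁ y₂)) + len G (horizontal y₂ (segment b c))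
                             ≡⟨ cong₂ _+_ (cong₂ _+_ (len-horizontal y₁ a b) (len-vertical b y₁ y₂)) (len-horizontal y₂ b c) ⟩
    ab + y₁y₂ + bc           ≡⟨ +-assoc ab y₁y₂ bc ⟩
    ab + (y₁y₂ + bc)         ≡⟨ cong (ab +_) (+-comm y₁y₂ bc) ⟩
    ab + (bc + y₁y₂)         ≡⟨ +-assoc ab bc y₁y₂ ⟨
    ab + bc + y₁y₂           ≡⟨ cong (_+ y₁y₂) (Between⇒∣-∣-additive abc) ⟩
    dist (a , y₁) (c , y₂)   ∎
    where
    open ≡-Reasoning
    ab bc y₁y₂ : ℕ
    ab = ∣ toℕ a - toℕ b ∣
    bc = ∣ toℕ b - toℕ c ∣
    y₁y₂ = ∣ toℕ y₁ - toℕ y₂ ∣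

  len-vhv : ∀ {x₁ x₂ : Fin r} {a b c : Fin s} → Between (toℕ a) (toℕ b) (toℕ c) →
            len G (vhv x₁ x₂ a b c) ≡ dist (x₁ , a) (x₂ , c)
  len-vhv {x₁} {x₂} {a} {b} {c} abc = begin
    len G (vhv x₁ x₂ a b c)  ≡⟨ len-legs (vertical x₁ (segment a b)) _ _ ⟩
    len G (vertical x₁ (segment a b)) + len G (horizontal b (segment x₁ x₂)) + len G (vertical x₂ (segment b c))
                             ≡⟨ cong₂ _+_ (cong₂ _+_ (len-vertical x₁ a b) (len-horizontal b x₁ x₂)) (len-vertical x₂ b c) ⟩
    ab + x₁x₂ + bc           ≡⟨ cong (_+ bc) (+-comm ab x₁x₂) ⟩
    x₁x₂ + ab + bc           ≡⟨ +-assoc x₁x₂ ab bc ⟩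
    x₁x₂ + (ab + bc)         ≡⟨ cong (x₁x₂ +_) (Between⇒∣-∣-additive abc) ⟩
    dist (x₁ , a) (x₂ , c)   ∎
    where
    open ≡-Reasoning
    ab bc x₁x₂ : ℕ
    ab = ∣ toℕ a - toℕ b ∣
    bc = ∣ toℕ b - toℕ c ∣
    x₁x₂ = ∣ toℕ x₁ - toℕ x₂ ∣

  hvh-geodesic : ∀ {a b c : Fin r} {y₁ y₂ : Fin s} → Between (toℕ a) (toℕ b) (toℕ c) → Geodesic G (hvh a b c y₁ y₂)
  hvh-geodesic abc = len≡dist⇒Geodesic _ (len-hvh abc)

  vhv-geodesic : ∀ {x₁ x₂ : Fin r} {a b c : Fin s} → Between (toℕ a) (toℕ b) (toℕ c) → Geodesic G (vhv x₁ x₂ a b c)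
  vhv-geodesic abc = len≡dist⇒Geodesic _ (len-vhv abc)

  Geodesic⇒len≤dist : ∀ {u v} (W : Walk G u v) → Geodesic G W → len G W ≤ dist u v
  Geodesic⇒len≤dist {a , y₁} {c , y₂} W geo =
    ≤-trans (geo (hvh a a c y₁ y₂)) (≤-reflexive (len-hvh (Between-refl (toℕ a) (toℕ c))))

  geodesic-len-πˣ : ∀ {u v} (W : Walk G u v) → Geodesic G W → len (P r) (πˣ W) ≤ ∣ X u - X v ∣
  geodesic-len-πˣ {u} {v} W geo = +-cancelʳ-≤ (len (P s) (πʸ W)) _ _ (begin
    len (P r) (πˣ W) + len (P s) (πʸ W) ≡⟨ len≡len-πˣ+len-πʸ W ⟨
    len G W                             ≤⟨ Geodesic⇒len≤dist W geo ⟩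
    ∣ X u - X v ∣ + ∣ Y u - Y v ∣       ≤⟨ +-monoʳ-≤ ∣ X u - X v ∣ (∣-∣≤len (πʸ W)) ⟩
    ∣ X u - X v ∣ + len (P s) (πʸ W)    ∎)
    where open ≤-Reasoning

  geodesic-len-πʸ : ∀ {u v} (W : Walk G u v) → Geodesic G W → len (P s) (πʸ W) ≤ ∣ Y u - Y v ∣
  geodesic-len-πʸ {u} {v} W geo = +-cancelˡ-≤ (len (P r) (πˣ W)) _ _ (begin
    len (P r) (πˣ W) + len (P s) (πʸ W) ≡⟨ len≡len-πˣ+len-πʸ W ⟨
    len G W                             ≤⟨ Geodesic⇒len≤dist W geo ⟩
    ∣ X u - X v ∣ + ∣ Y u - Y v ∣       ≤⟨ +-monoˡ-≤ ∣ Y u - Y v ∣ (∣-∣≤len (πˣ W)) ⟩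
    len (P r) (πˣ W) + ∣ Y u - Y v ∣    ∎)
    where open ≤-Reasoning

  geodesic-X-monotone : ∀ {u v} (W : Walk G u v) → Geodesic G W → Monotone (λ k → X (vertexAt W k))
  geodesic-X-monotone W geo with len≤∣-∣⇒one-way (πˣ W) (geodesic-len-πˣ W geo)
  ... | inj₁ ups≡0   = inj₂ (Steps-chain ≤-refl (λ p q → ≤-trans q p) W
                              (Steps-πˣ ≤-refl W (ups≡0⇒descending (πˣ W) ups≡0)))
  ... | inj₂ downs≡0 = inj₁ (Steps-chain ≤-refl ≤-trans W (Steps-πˣ ≤-refl W (downs≡0⇒ascending (πˣ W) downs≡0)))

  geodesic-Y-monotone : ∀ {u v} (W : Walk G u v) → Geodesic G W → Monotone (λ k → Y (vertexAt W k))
  geodesic-Y-monotone W geo with len≤∣-∣⇒one-way (πʸ W) (geodesic-len-πʸ W geo)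
  ... | inj₁ ups≡0   = inj₂ (Steps-chain ≤-refl (λ p q → ≤-trans q p) W
                              (Steps-πʸ ≤-refl W (ups≡0⇒descending (πʸ W) ups≡0)))
  ... | inj₂ downs≡0 = inj₁ (Steps-chain ≤-refl ≤-trans W (Steps-πʸ ≤-refl W (downs≡0⇒ascending (πʸ W) downs≡0)))

  XCut YCut : ℕ → Edge G → Set
  XCut c (u , v) = Straddles c (X u) (X v)
  YCut c (u , v) = Straddles c (Y u) (Y v)

  private
    Straddles-swap : ∀ {c a b} → Straddles c a b → Straddles c b a
    Straddles-swap (inj₁ (p , q)) = inj₂ (q , p)
    Straddles-swap (inj₂ (p , q)) = inj₁ (q , p)

    XCut-resp : ∀ {c e f} → SameEdge G e f → XCut c e → XCut c f
    XCut-resp (inj₁ refl) = λ x → x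
    XCut-resp (inj₂ refl) = Straddles-swap

    YCut-resp : ∀ {c e f} → SameEdge G e f → YCut c e → YCut c f
    YCut-resp (inj₁ refl) = λ y → y
    YCut-resp (inj₂ refl) = Straddles-swap

  geodesic-XCut-unique : ∀ {u v} (W : Walk G u v) → Geodesic G W → ∀ {c e f} →
                         EdgeOn G e W → EdgeOn G f W → XCut c e → XCut c f → SameEdge G e f
  geodesic-XCut-unique W geo e∈W f∈W ce cf with EdgeOn⇒consecutive W e∈W | EdgeOn⇒consecutive W f∈W
  ... | i , e≈ | j , f≈ with Monotone-straddles-once (geodesic-X-monotone W geo) (XCut-resp e≈ ce) (XCut-resp f≈ cf)
  ... | refl = SameEdge-trans {G = G} e≈ (SameEdge-sym {G = G} f≈)

  geodesic-YCut-unique : ∀ {u v} (W : Walk G u v) → Geodesic G W → ∀ {c e f} →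
                         EdgeOn G e W → EdgeOn G f W → YCut c e → YCut c f → SameEdge G e f
  geodesic-YCut-unique W geo e∈W f∈W ce cf with EdgeOn⇒consecutive W e∈W | EdgeOn⇒consecutive W f∈W
  ... | i , e≈ | j , f≈ with Monotone-straddles-once (geodesic-Y-monotone W geo) (YCut-resp e≈ ce) (YCut-resp f≈ cf)
  ... | refl = SameEdge-trans {G = G} e≈ (SameEdge-sym {G = G} f≈)

  geodesic-Between-Y : ∀ {u v} (W : Walk G u v) → Geodesic G W → ∀ {i j k} →
                       X (vertexAt W i) < X (vertexAt W j) → X (vertexAt W j) < X (vertexAt W k) →
                       Between (Y (vertexAt W i)) (Y (vertexAt W j)) (Y (vertexAt W k))
  geodesic-Between-Y W geo {i} {j} {k} ij jk =
    Monotone-Between (geodesic-Y-monotone W geo) {i} {j} {k} (Monotone-<-Between (geodesic-X-monotone W geo) ij jk)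

  geodesic-Between-X : ∀ {u v} (W : Walk G u v) → Geodesic G W → ∀ {i j k} →
                       Y (vertexAt W i) < Y (vertexAt W j) → Y (vertexAt W j) < Y (vertexAt W k) →
                       Between (X (vertexAt W i)) (X (vertexAt W j)) (X (vertexAt W k))
  geodesic-Between-X W geo {i} {j} {k} ij jk =
    Monotone-Between (geodesic-X-monotone W geo) {i} {j} {k} (Monotone-<-Between (geodesic-Y-monotone W geo) ij jk)

  hEdge : Fin r → Fin r → Fin s → Edge G
  hEdge p q y = (p , y) , (q , y)

  vEdge : Fin r → Fin s → Fin s → Edge G
  vEdge x p q = (x , p) , (x , q)

  grid-edge-cases : ∀ e → Adj G (proj₁ e) (proj₂ e) →
                    (∃₂ λ p q → ∃ λ y → suc (toℕ p) ≡ toℕ q × SameEdge G e (hEdge p q y))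
                  ⊎ (∃₂ λ x p → ∃ λ q → suc (toℕ p) ≡ toℕ q × SameEdge G e (vEdge x p q))
  grid-edge-cases ((x , y) , (x′ , .y)) (inj₁ (inj₁ pq , refl)) = inj₁ (x , x′ , y , pq , inj₁ refl)
  grid-edge-cases ((x , y) , (x′ , .y)) (inj₁ (inj₂ pq , refl)) = inj₁ (x′ , x , y , pq , inj₂ refl)
  grid-edge-cases ((x , y) , (.x , y′)) (inj₂ (refl , inj₁ pq)) = inj₂ (x , y , y′ , pq , inj₁ refl)
  grid-edge-cases ((x , y) , (.x , y′)) (inj₂ (refl , inj₂ pq)) = inj₂ (x , y′ , y , pq , inj₂ refl)

  module _ {a b c : Fin r} {y₁ y₂ : Fin s} where

    hvh-first : ∀ {p q} → suc (toℕ p) ≡ toℕ q → toℕ a ⊓ toℕ b ≤ toℕ p → toℕ q ≤ toℕ a ⊔ toℕ b →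
                EdgeOn G (hEdge p q y₁) (hvh a b c y₁ y₂)
    hvh-first pq lo hi = EdgeOn-++ˡ _ (EdgeOn-mapᵂ _ _ (EdgeOn-segment a b pq lo hi))

    hvh-middle : ∀ {p q} → suc (toℕ p) ≡ toℕ q → toℕ y₁ ⊓ toℕ y₂ ≤ toℕ p → toℕ q ≤ toℕ y₁ ⊔ toℕ y₂ →
                 EdgeOn G (vEdge b p q) (hvh a b c y₁ y₂)
    hvh-middle pq lo hi = EdgeOn-++ʳ (horizontal y₁ (segment a b))
                            (EdgeOn-++ˡ _ (EdgeOn-mapᵂ _ _ (EdgeOn-segment y₁ y₂ pq lo hi)))

    hvh-last : ∀ {p q} → suc (toℕ p) ≡ toℕ q → toℕ b ⊓ toℕ c ≤ toℕ p → toℕ q ≤ toℕ b ⊔ toℕ c →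
               EdgeOn G (hEdge p q y₂) (hvh a b c y₁ y₂)
    hvh-last pq lo hi = EdgeOn-++ʳ (horizontal y₁ (segment a b))
                          (EdgeOn-++ʳ (vertical b (segment y₁ y₂)) (EdgeOn-mapᵂ _ _ (EdgeOn-segment b c pq lo hi)))

  module _ {x₁ x₂ : Fin r} {a b c : Fin s} where

    vhv-first : ∀ {p q} → suc (toℕ p) ≡ toℕ q → toℕ a ⊓ toℕ b ≤ toℕ p → toℕ q ≤ toℕ a ⊔ toℕ b →
                EdgeOn G (vEdge x₁ p q) (vhv x₁ x₂ a b c)
    vhv-first pq lo hi = EdgeOn-++ˡ _ (EdgeOn-mapᵂ _ _ (EdgeOn-segment a b pq lo hi))

    vhv-middle : ∀ {p q} → suc (toℕ p) ≡ toℕ q → toℕ x₁ ⊓ toℕ x₂ ≤ toℕ p → toℕ q ≤ toℕ x₁ ⊔ toℕ x₂ →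
                 EdgeOn G (hEdge p q b) (vhv x₁ x₂ a b c)
    vhv-middle pq lo hi = EdgeOn-++ʳ (vertical x₁ (segment a b))
                            (EdgeOn-++ˡ _ (EdgeOn-mapᵂ _ _ (EdgeOn-segment x₁ x₂ pq lo hi)))

    vhv-last : ∀ {p q} → suc (toℕ p) ≡ toℕ q → toℕ b ⊓ toℕ c ≤ toℕ p → toℕ q ≤ toℕ b ⊔ toℕ c →
               EdgeOn G (vEdge x₂ p q) (vhv x₁ x₂ a b c)
    vhv-last pq lo hi = EdgeOn-++ʳ (vertical x₁ (segment a b))
                          (EdgeOn-++ʳ (horizontal b (segment x₁ x₂)) (EdgeOn-mapᵂ _ _ (EdgeOn-segment b c pq lo hi)))

-- Double counting

module _ {A : Set} where

  sum-map-+ : (f g : A → ℕ) (xs : List A) → sum (map (λ x → f x + g x) xs) ≡ sum (map f xs) + sum (map g xs)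
  sum-map-+ f g []       = refl
  sum-map-+ f g (x ∷ xs) = trans (cong (f x + g x +_) (sum-map-+ f g xs)) (+-interchange (f x) (g x) _ _)

  sum-map-≤ : {f g : A → ℕ} {xs : List A} → All (λ x → f x ≤ g x) xs → sum (map f xs) ≤ sum (map g xs)
  sum-map-≤ []         = z≤n
  sum-map-≤ (le ∷ les) = +-mono-≤ le (sum-map-≤ les)

  sum-map-const : (k : ℕ) (xs : List A) → sum (map (λ _ → k) xs) ≡ k * length xs
  sum-map-const k []       = sym (*-zeroʳ k)
  sum-map-const k (x ∷ xs) = trans (cong (k +_) (sum-map-const k xs)) (sym (*-suc k (length xs)))

  length-concatMap : ∀ {B : Set} {k} (f : A → List B) → (∀ x → length (f x) ≡ k) → ∀ xs →
                     length (concatMap f xs) ≡ k * length xs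
  length-concatMap {k = k} f len-f []       = sym (*-zeroʳ k)
  length-concatMap {k = k} f len-f (x ∷ xs) = begin
    length (f x ++ concatMap f xs)        ≡⟨ length-++ (f x) ⟩
    length (f x) + length (concatMap f xs) ≡⟨ cong₂ _+_ (len-f x) (length-concatMap f len-f xs) ⟩
    k + k * length xs                     ≡⟨ *-suc k (length xs) ⟨
    k * length (x ∷ xs)                   ∎
    where open ≡-Reasoning

  ∈⇒≤sum-map : (f : A → ℕ) {x : A} {xs : List A} → x ∈ xs → f x ≤ sum (map f xs)
  ∈⇒≤sum-map f (here refl) = m≤m+n _ _
  ∈⇒≤sum-map f {xs = y ∷ xs} (there x∈xs) = ≤-trans (∈⇒≤sum-map f x∈xs) (m≤n+m _ (f y))

𝟙 : ∀ {P : Set} → Dec P → ℕ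
𝟙 (yes _) = 1
𝟙 (no _)  = 0

𝟙-yes : ∀ {P : Set} (d : Dec P) → P → 1 ≤ 𝟙 d
𝟙-yes (yes _) _ = ≤-refl
𝟙-yes (no ¬p) p = ⊥-elim (¬p p)

𝟙-mono : ∀ {P Q : Set} → (P → Q) → (d : Dec P) (d′ : Dec Q) → 𝟙 d ≤ 𝟙 d′
𝟙-mono f (yes p) d′ = 𝟙-yes d′ (f p)
𝟙-mono f (no _)  d′ = z≤n

count : ∀ {A : Set} {P : A → Set} → (∀ x → Dec (P x)) → List A → ℕ
count P? xs = sum (map (λ x → 𝟙 (P? x)) xs)

module _ {A : Set} {P : A → Set} (P? : ∀ x → Dec (P x)) where

  count+count-¬≡length : ∀ xs → count P? xs + count (¬? ∘ P?) xs ≡ length xs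
  count+count-¬≡length []       = refl
  count+count-¬≡length (x ∷ xs) with P? x
  ... | yes _ = cong suc (count+count-¬≡length xs)
  ... | no  _ = trans (+-suc (count P? xs) (count (¬? ∘ P?) xs)) (cong suc (count+count-¬≡length xs))

  count≡length-filter : ∀ xs → count P? xs ≡ length (filter P? xs)
  count≡length-filter []       = refl
  count≡length-filter (x ∷ xs) with P? x
  ... | yes _ = cong suc (count≡length-filter xs)
  ... | no  _ = count≡length-filter xs

  private
    fsuc-≢ : ∀ {n} {i j : Fin n} → i ≢ j → fsuc i ≢ fsuc j
    fsuc-≢ i≢j = i≢j ∘ fsuc-injective

  count≥1⇒witness : ∀ xs → 1 ≤ count P? xs → ∃ λ i → P (lookup xs i)
  count≥1⇒witness (x ∷ xs) le with P? x
  ... | yes p = fzero , p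
  ... | no _  = let i , q = count≥1⇒witness xs le in fsuc i , q

  count≥2⇒witnesses : ∀ xs → 2 ≤ count P? xs → ∃₂ λ i j → i ≢ j × P (lookup xs i) × P (lookup xs j)
  count≥2⇒witnesses (x ∷ xs) le with P? x
  ... | yes p = let j , q = count≥1⇒witness xs (s≤s⁻¹ le) in fzero , fsuc j , (λ ()) , p , q
  ... | no _  = let i , j , i≢j , p , q = count≥2⇒witnesses xs le in fsuc i , fsuc j , fsuc-≢ i≢j , p , q

  count≥3⇒witnesses : ∀ xs → 3 ≤ count P? xs →
    ∃₂ λ i j → ∃ λ k → i ≢ j × j ≢ k × i ≢ k × P (lookup xs i) × P (lookup xs j) × P (lookup xs k)
  count≥3⇒witnesses (x ∷ xs) le with P? x
  ... | yes p = let j , k , j≢k , q , q′ = count≥2⇒witnesses xs (s≤s⁻¹ le) in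
                fzero , fsuc j , fsuc k , (λ ()) , fsuc-≢ j≢k , (λ ()) , p , q , q′
  ... | no _  = let i , j , k , i≢j , j≢k , i≢k , p , q , q′ = count≥3⇒witnesses xs le in
                fsuc i , fsuc j , fsuc k , fsuc-≢ i≢j , fsuc-≢ j≢k , fsuc-≢ i≢k , p , q , q′

record GeodesicWalk (G : Graph) : Set where
  constructor geodesic
  field
    {start end} : V G
    walk        : Walk G start end
    isGeodesic  : Geodesic G walk
open GeodesicWalk

module Covering {G : Graph} (_≟_ : DecidableEquality (V G)) where

  EdgeOn? : ∀ e {u v} (W : Walk G u v) → Dec (EdgeOn G e W)
  EdgeOn? e [] = no λ ()
  EdgeOn? e (_∷_ {u} {w} a W) with ≡-dec _≟_ _≟_ e (u , w) ⊎-dec ≡-dec _≟_ _≟_ e (w , u) | EdgeOn? e W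
  ... | yes e≈uw | _        = yes (here a W e≈uw)
  ... | no _     | yes e∈W  = yes (there a e∈W)
  ... | no e≉uw  | no e∉W   = no λ { (here _ _ e≈uw) → e≉uw e≈uw ; (there _ e∈W) → e∉W e∈W }

  cover : Edge G → List (GeodesicWalk G) → ℕ
  cover e = count (λ g → EdgeOn? e (walk g))

  cover-++ : ∀ e Gs Hs → cover e (Gs ++ Hs) ≡ cover e Gs + cover e Hs
  cover-++ e Gs Hs = trans (cong sum (map-++ _ Gs Hs)) (sum-++ (map _ Gs) _)

  cover-concatMap : ∀ {I : Set} e (f : I → List (GeodesicWalk G)) xs →
                    cover e (concatMap f xs) ≡ sum (map (λ x → cover e (f x)) xs)
  cover-concatMap e f []       = refl
  cover-concatMap e f (x ∷ xs) = trans (cover-++ e (f x) _) (cong (cover e (f x) +_) (cover-concatMap e f xs))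

  length≤cover-concatMap : ∀ {I : Set} e (f : I → List (GeodesicWalk G)) xs →
                           (∀ x → 1 ≤ cover e (f x)) → length xs ≤ cover e (concatMap f xs)
  length≤cover-concatMap e f xs covered = begin
    length xs                             ≡⟨ *-identityˡ (length xs) ⟨
    1 * length xs                         ≡⟨ sum-map-const 1 xs ⟨
    sum (map (λ _ → 1) xs)                ≤⟨ sum-map-≤ {xs = xs} (All.tabulate (λ {x} _ → covered x)) ⟩
    sum (map (λ x → cover e (f x)) xs)    ≡⟨ cover-concatMap e f xs ⟨
    cover e (concatMap f xs)              ∎
    where open ≤-Reasoning

  ∈⇒cover≤cover-concatMap : ∀ {I : Set} e (f : I → List (GeodesicWalk G)) {x xs} → x ∈ xs →
                            cover e (f x) ≤ cover e (concatMap f xs)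
  ∈⇒cover≤cover-concatMap e f {xs = xs} x∈xs =
    ≤-trans (∈⇒≤sum-map (λ x → cover e (f x)) x∈xs) (≤-reflexive (sym (cover-concatMap e f xs)))

  cover-++-≤ : ∀ {a b} e Gs Hs → a ≤ cover e Gs → b ≤ cover e Hs → a + b ≤ cover e (Gs ++ Hs)
  cover-++-≤ e Gs Hs a≤ b≤ = ≤-trans (+-mono-≤ a≤ b≤) (≤-reflexive (sym (cover-++ e Gs Hs)))

  cover-pair-either : ∀ {e} g h → EdgeOn G e (walk g) ⊎ EdgeOn G e (walk h) → 1 ≤ cover e (g ∷ h ∷ [])
  cover-pair-either g h (inj₁ on) = ≤-trans (𝟙-yes (EdgeOn? _ (walk g)) on) (m≤m+n _ _)
  cover-pair-either g h (inj₂ on) =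
    ≤-trans (m≤n⇒m≤n+o 0 (𝟙-yes (EdgeOn? _ (walk h)) on)) (m≤n+m _ (𝟙 (EdgeOn? _ (walk g))))

  cover-pair-both : ∀ {e} g h → EdgeOn G e (walk g) → EdgeOn G e (walk h) → 2 ≤ cover e (g ∷ h ∷ [])
  cover-pair-both g h on on′ = +-mono-≤ (𝟙-yes (EdgeOn? _ (walk g)) on) (m≤n⇒m≤n+o 0 (𝟙-yes (EdgeOn? _ (walk h)) on′))

  cover-resp : ∀ {e f} Gs → SameEdge G e f → cover e Gs ≤ cover f Gs
  cover-resp []       e≈f = z≤n
  cover-resp (g ∷ Gs) e≈f = +-mono-≤ (𝟙-mono (EdgeOn-resp e≈f) (EdgeOn? _ (walk g)) (EdgeOn? _ (walk g))) (cover-resp Gs e≈f)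

  on-geodesic≤2 : ∀ S → IsEdgeGP G S → ∀ {u v} (W : Walk G u v) → Geodesic G W → count (λ e → EdgeOn? e W) S ≤ 2
  on-geodesic≤2 S gp W geo with count (λ e → EdgeOn? e W) S ≤? 2
  ... | yes le = le
  ... | no  gt with count≥3⇒witnesses (λ e → EdgeOn? e W) S (≰⇒> gt)
  ... | i , j , k , i≢j , j≢k , i≢k , eᵢ , eⱼ , eₖ = ⊥-elim (gp W geo i j k i≢j j≢k i≢k (eᵢ , eⱼ , eₖ))

  Σcover≤2*length : ∀ S → IsEdgeGP G S → ∀ Gs → sum (map (λ e → cover e Gs) S) ≤ 2 * length Gs
  Σcover≤2*length S gp []       = ≤-reflexive (sum-map-const 0 S)
  Σcover≤2*length S gp (g ∷ Gs) = begin
    sum (map (λ e → 𝟙 (EdgeOn? e (walk g)) + cover e Gs) S)             ≡⟨ sum-map-+ _ _ S ⟩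
    count (λ e → EdgeOn? e (walk g)) S + sum (map (λ e → cover e Gs) S) ≤⟨ +-mono-≤ (on-geodesic≤2 S gp (walk g) (isGeodesic g))
                                                                                     (Σcover≤2*length S gp Gs) ⟩
    2 + 2 * length Gs                                                   ≡⟨ *-suc 2 (length Gs) ⟨
    2 * length (g ∷ Gs)                                                 ∎
    where open ≤-Reasoning

  weighted-cover-bound : (w : Edge G → ℕ) (Gs : List (GeodesicWalk G)) →
                         (∀ e → Adj G (proj₁ e) (proj₂ e) → w e ≤ cover e Gs) →
                         ∀ S → IsEdgeSet G S → IsEdgeGP G S → sum (map w S) ≤ 2 * length Gs
  weighted-cover-bound w Gs w≤cover S (adj , _) gp =
    ≤-trans (sum-map-≤ (All.map (λ {e} → w≤cover e) adj)) (Σcover≤2*length S gp Gs)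

  double-cover-bound : (Gs : List (GeodesicWalk G)) → (∀ e → Adj G (proj₁ e) (proj₂ e) → 2 ≤ cover e Gs) →
                       ∀ S → IsEdgeSet G S → IsEdgeGP G S → length S ≤ length Gs
  double-cover-bound Gs covered S es gp = *-cancelˡ-≤ 2
    (≤-trans (≤-reflexive (sym (sum-map-const 2 S))) (weighted-cover-bound (λ _ → 2) Gs covered S es gp))

-- Edge general position from classes of edges

AllPairs-lookup : ∀ {A : Set} {R : A → A → Set} → (∀ {a b} → R a b → R b a) → ∀ {xs} → AllPairs R xs →
                  ∀ {i j} → i ≢ j → R (lookup xs i) (lookup xs j)
AllPairs-lookup sym′ (rs ∷ _)   {fzero}  {fzero}  i≢j = ⊥-elim (i≢j refl)
AllPairs-lookup sym′ (rs ∷ _)   {fzero}  {fsuc j} _   = All.lookup rs (∈-lookup j)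
AllPairs-lookup sym′ (rs ∷ _)   {fsuc i} {fzero}  _   = sym′ (All.lookup rs (∈-lookup i))
AllPairs-lookup sym′ (_ ∷ rss)  {fsuc i} {fsuc j} i≢j = AllPairs-lookup sym′ rss (λ i≡j → i≢j (cong fsuc i≡j))

module _ {G : Graph} where

  OnePerGeodesic : (Edge G → Set) → Set
  OnePerGeodesic C = ∀ {u v} (W : Walk G u v) → Geodesic G W → ∀ {e f} →
                     EdgeOn G e W → EdgeOn G f W → C e → C f → SameEdge G e f

  NoCommonGeodesic : (C₁ C₂ C₃ : Edge G → Set) → Set
  NoCommonGeodesic C₁ C₂ C₃ = ∀ {u v} (W : Walk G u v) → Geodesic G W → ∀ {e₁ e₂ e₃} →
                              EdgeOn G e₁ W → EdgeOn G e₂ W → EdgeOn G e₃ W → C₁ e₁ → C₂ e₂ → C₃ e₃ → ⊥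

  -- Sorting the labels of three edges on a geodesic leaves two edges of one class or labels l₁ < l₂ < l₃.
  classes⇒EdgeGP : ∀ {k} (C : Fin k → Edge G → Set) → (∀ l → OnePerGeodesic (C l)) →
                   (∀ {l₁ l₂ l₃} → l₁ <ᶠ l₂ → l₂ <ᶠ l₃ → NoCommonGeodesic (C l₁) (C l₂) (C l₃)) →
                   ∀ S → AllPairs (λ e f → ¬ SameEdge G e f) S → All (λ e → ∃ λ l → C l e) S → IsEdgeGP G S
  classes⇒EdgeGP C one none S distinct classified W geo i j k i≢j j≢k i≢k (eᵢ , eⱼ , eₖ) =
    sort (All.lookup classified (∈-lookup i)) (All.lookup classified (∈-lookup j)) (All.lookup classified (∈-lookup k))
    where
    apart : ∀ {a b} → a ≢ b → ¬ SameEdge G (lookup S a) (lookup S b)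
    apart = AllPairs-lookup (λ ¬ab ba → ¬ab (SameEdge-sym {G = G} ba)) distinct

    sort : ∃ (λ l → C l (lookup S i)) → ∃ (λ l → C l (lookup S j)) → ∃ (λ l → C l (lookup S k)) → ⊥
    sort (l₁ , c₁) (l₂ , c₂) (l₃ , c₃) with <-cmpᶠ l₁ l₂ | <-cmpᶠ l₂ l₃ | <-cmpᶠ l₁ l₃
    ... | tri≈ _ refl _ | _             | _             = apart i≢j (one l₁ W geo eᵢ eⱼ c₁ c₂)
    ... | _             | tri≈ _ refl _ | _             = apart j≢k (one l₂ W geo eⱼ eₖ c₂ c₃)
    ... | _             | _             | tri≈ _ refl _ = apart i≢k (one l₁ W geo eᵢ eₖ c₁ c₃)
    ... | tri< a _ _    | tri< b _ _    | _             = none a b W geo eᵢ eⱼ eₖ c₁ c₂ c₃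
    ... | tri< a _ _    | tri> _ _ b    | tri< c _ _    = none c b W geo eᵢ eₖ eⱼ c₁ c₃ c₂
    ... | tri< a _ _    | tri> _ _ b    | tri> _ _ c    = none c a W geo eₖ eᵢ eⱼ c₃ c₁ c₂
    ... | tri> _ _ a    | tri< b _ _    | tri< c _ _    = none a c W geo eⱼ eᵢ eₖ c₂ c₁ c₃
    ... | tri> _ _ a    | tri< b _ _    | tri> _ _ c    = none b c W geo eⱼ eₖ eᵢ c₂ c₃ c₁
    ... | tri> _ _ a    | tri> _ _ b    | _             = none b a W geo eₖ eⱼ eᵢ c₃ c₂ c₁

no-sorted-triple-in-Fin2 : ∀ {l₁ l₂ l₃ : Fin 2} → l₁ <ᶠ l₂ → l₂ <ᶠ l₃ → ⊥
no-sorted-triple-in-Fin2 {l₃ = l₃} l₁<l₂ l₂<l₃ =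
  <⇒≱ (≤-trans (s≤s (≤-trans (s≤s z≤n) l₁<l₂)) l₂<l₃) (toℕ≤pred[n] l₃)

two-classes⇒EdgeGP : ∀ {G : Graph} (C : Fin 2 → Edge G → Set) → (∀ l → OnePerGeodesic (C l)) →
                     ∀ S → AllPairs (λ e f → ¬ SameEdge G e f) S → All (λ e → ∃ λ l → C l e) S → IsEdgeGP G S
two-classes⇒EdgeGP C one = classes⇒EdgeGP C one (λ l₁<l₂ l₂<l₃ → ⊥-elim (no-sorted-triple-in-Fin2 l₁<l₂ l₂<l₃))

-- Staircase geodesics covering a grid

module Staircases (r₁ s₁ : ℕ) where

  G : Graph
  G = Grid (suc r₁) (suc s₁)
  open Covering {G} (≡-dec _≟ᶠ_ _≟ᶠ_) public

  right : Fin (suc r₁)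
  right = fromℕ r₁

  top : Fin (suc s₁)
  top = fromℕ s₁

  ≤right : (x : Fin (suc r₁)) → toℕ x ≤ toℕ right
  ≤right x = subst (toℕ x ≤_) (sym (toℕ-fromℕ r₁)) (toℕ≤pred[n] x)

  ≤top : (y : Fin (suc s₁)) → toℕ y ≤ toℕ top
  ≤top y = subst (toℕ y ≤_) (sym (toℕ-fromℕ s₁)) (toℕ≤pred[n] y)

  column↗ column↘ : Fin (suc r₁) → GeodesicWalk G
  column↗ x = geodesic (hvh fzero x right fzero top) (hvh-geodesic (inj₁ (z≤n , ≤right x)))
  column↘ x = geodesic (hvh fzero x right top fzero) (hvh-geodesic (inj₁ (z≤n , ≤right x)))

  row↗ row↘ : Fin (suc s₁) → GeodesicWalk G
  row↗ y = geodesic (vhv fzero right fzero y top) (vhv-geodesic (inj₁ (z≤n , ≤top y)))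
  row↘ y = geodesic (vhv fzero right top y fzero) (vhv-geodesic (inj₂ (z≤n , ≤top y)))

  columnPair : Fin (suc r₁) → List (GeodesicWalk G)
  columnPair x = column↗ x ∷ column↘ x ∷ []

  rowPair : Fin (suc s₁) → List (GeodesicWalk G)
  rowPair y = row↗ y ∷ row↘ y ∷ []

  private
    split : ∀ {n} {p q : Fin n} (x : Fin n) → suc (toℕ p) ≡ toℕ q → toℕ q ≤ toℕ x ⊎ toℕ x ≤ toℕ p
    split {p = p} {q} x pq with toℕ q ≤? toℕ x
    ... | yes q≤x = inj₁ q≤x
    ... | no  q≰x = inj₂ (s≤s⁻¹ (≤-trans (≰⇒> q≰x) (≤-reflexive (sym pq))))

  module _ {p q : Fin (suc r₁)} (pq : suc (toℕ p) ≡ toℕ q) where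

    bottom-on-column↗-right : EdgeOn G (hEdge p q fzero) (walk (column↗ right))
    bottom-on-column↗-right = hvh-first pq z≤n (≤right q)

    top-on-column↗-left : EdgeOn G (hEdge p q top) (walk (column↗ fzero))
    top-on-column↗-left = hvh-last pq z≤n (≤right q)

    bottom-on-columnPair : ∀ x → 1 ≤ cover (hEdge p q fzero) (columnPair x)
    bottom-on-columnPair x with split x pq
    ... | inj₁ q≤x = cover-pair-either (column↗ x) (column↘ x) (inj₁ (hvh-first pq z≤n q≤x))
    ... | inj₂ x≤p = cover-pair-either (column↗ x) (column↘ x)
                       (inj₂ (hvh-last pq (m≤n⇒m⊓o≤n _ x≤p) (m≤n⇒m≤o⊔n _ (≤right q))))

    top-on-columnPair : ∀ x → 1 ≤ cover (hEdge p q top) (columnPair x)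
    top-on-columnPair x with split x pq
    ... | inj₁ q≤x = cover-pair-either (column↗ x) (column↘ x) (inj₂ (hvh-first pq z≤n q≤x))
    ... | inj₂ x≤p = cover-pair-either (column↗ x) (column↘ x)
                       (inj₁ (hvh-last pq (m≤n⇒m⊓o≤n _ x≤p) (m≤n⇒m≤o⊔n _ (≤right q))))

    hEdge-on-rowPair : ∀ y → 2 ≤ cover (hEdge p q y) (rowPair y)
    hEdge-on-rowPair y = cover-pair-both (row↗ y) (row↘ y) (vhv-middle pq z≤n (≤right q)) (vhv-middle pq z≤n (≤right q))

  module _ {p q : Fin (suc s₁)} (pq : suc (toℕ p) ≡ toℕ q) where

    vEdge-on-column↗ : ∀ x → EdgeOn G (vEdge x p q) (walk (column↗ x))
    vEdge-on-column↗ x = hvh-middle pq z≤n (≤top q)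

    vEdge-on-columnPair : ∀ x → 2 ≤ cover (vEdge x p q) (columnPair x)
    vEdge-on-columnPair x = cover-pair-both (column↗ x) (column↘ x) (vEdge-on-column↗ x)
      (hvh-middle pq (m≤n⇒o⊓m≤n (toℕ top) z≤n) (m≤n⇒m≤n⊔o 0 (≤top q)))

    left-on-rowPair : ∀ y → 1 ≤ cover (vEdge fzero p q) (rowPair y)
    left-on-rowPair y with split y pq
    ... | inj₁ q≤y = cover-pair-either (row↗ y) (row↘ y) (inj₁ (vhv-first pq z≤n q≤y))
    ... | inj₂ y≤p = cover-pair-either (row↗ y) (row↘ y)
                       (inj₂ (vhv-first pq (m≤n⇒o⊓m≤n _ y≤p) (m≤n⇒m≤n⊔o _ (≤top q))))

    right-on-rowPair : ∀ y → 1 ≤ cover (vEdge right p q) (rowPair y)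
    right-on-rowPair y with split y pq
    ... | inj₁ q≤y = cover-pair-either (row↗ y) (row↘ y)
                       (inj₂ (vhv-last pq (m≤n⇒o⊓m≤n (toℕ y) z≤n) (m≤n⇒m≤n⊔o 0 q≤y)))
    ... | inj₂ y≤p = cover-pair-either (row↗ y) (row↘ y)
                       (inj₁ (vhv-last pq (m≤n⇒m⊓o≤n _ y≤p) (m≤n⇒m≤o⊔n _ (≤top q))))

  every-edge-covered : ∀ {k} Gs →
    (∀ {p q : Fin (suc r₁)} y → suc (toℕ p) ≡ toℕ q → k ≤ cover (hEdge p q y) Gs) →
    (∀ x {p q : Fin (suc s₁)} → suc (toℕ p) ≡ toℕ q → k ≤ cover (vEdge x p q) Gs) →
    ∀ e → Adj G (proj₁ e) (proj₂ e) → k ≤ cover e Gs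
  every-edge-covered Gs hCovered vCovered e adj with grid-edge-cases e adj
  ... | inj₁ (p , q , y , pq , e≈) = ≤-trans (hCovered y pq) (cover-resp Gs (SameEdge-sym {G = G} e≈))
  ... | inj₂ (x , p , q , pq , e≈) = ≤-trans (vCovered x pq) (cover-resp Gs (SameEdge-sym {G = G} e≈))

-- Two rows

-- With r = 2 + a and h = 2 + b, dropping a b from r h + 2 v ≤ 4 r leaves 2 (b + v) ≤ 2 r.
ladder-arithmetic : ∀ a h v → (2 + a) * h + 2 * v ≤ 2 * (2 * (2 + a)) → v ≤ 2 + a → h + v ≤ (2 + a) + 2
ladder-arithmetic a zero          v _ v≤r = ≤-trans v≤r (m≤m+n _ 2)
ladder-arithmetic a (suc zero)    v _ v≤r = ≤-trans (s≤s v≤r) (≤-trans (n≤1+n _) (≤-reflexive (+-comm 2 (2 + a))))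
ladder-arithmetic a (suc (suc b)) v ineq _ = begin
  2 + b + v       ≡⟨ +-assoc 2 b v ⟩
  2 + (b + v)     ≤⟨ +-monoʳ-≤ 2 (*-cancelˡ-≤ 2 (+-cancelʳ-≤ (2 * a + 4) _ _ doubled)) ⟩
  2 + (2 + a)     ≡⟨ +-comm 2 (2 + a) ⟩
  (2 + a) + 2     ∎
  where
  open ≤-Reasoning
  open +-*-Solver
  doubled : 2 * (b + v) + (2 * a + 4) ≤ 2 * (2 + a) + (2 * a + 4)
  doubled = begin
    2 * (b + v) + (2 * a + 4)           ≤⟨ +-monoʳ-≤ (2 * (b + v)) (m≤n+m (2 * a + 4) (a * b)) ⟩
    2 * (b + v) + (a * b + (2 * a + 4)) ≡⟨ solve 3 (λ a b v → con 2 :* (b :+ v) :+ (a :* b :+ (con 2 :* a :+ con 4))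
                                                 := (con 2 :+ a) :* (con 2 :+ b) :+ con 2 :* v) refl a b v ⟩
    (2 + a) * (2 + b) + 2 * v           ≤⟨ ineq ⟩
    2 * (2 * (2 + a))                   ≡⟨ solve 1 (λ a → con 2 :* (con 2 :* (con 2 :+ a))
                                                 := con 2 :* (con 2 :+ a) :+ (con 2 :* a :+ con 4)) refl a ⟩
    2 * (2 + a) + (2 * a + 4)           ∎

module LadderCase (r₂ : ℕ) where

  open Staircases (suc r₂) 1

  r : ℕ
  r = suc (suc r₂)

  rung : Fin r → Edge G
  rung x = vEdge x fzero (fsuc fzero)

  rails : Fin 2 → Edge G
  rails y = hEdge fzero (fsuc fzero) y

  S₂ : List (Edge G)
  S₂ = tabulate rung ++ tabulate rails

  length-S₂ : length S₂ ≡ r + 2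
  length-S₂ = trans (length-++ (tabulate rung)) (cong₂ _+_ (length-tabulate rung) (length-tabulate rails))

  S₂-edges : All (λ e → Adj G (proj₁ e) (proj₂ e)) S₂
  S₂-edges = All.++⁺ (All.tabulate⁺ {f = rung} λ _ → inj₂ (refl , inj₁ refl))
                     (All.tabulate⁺ {f = rails} λ _ → inj₁ (inj₁ refl , refl))

  S₂-distinct : AllPairs (λ e f → ¬ SameEdge G e f) S₂
  S₂-distinct = AllPairs.++⁺ (AllPairs.tabulate⁺ {f = rung} rungs-apart) (AllPairs.tabulate⁺ {f = rails} rails-apart)
                             (All.tabulate⁺ {f = rung} λ _ → All.tabulate⁺ {f = rails} λ _ → rung-rail-apart)
    where
    rungs-apart : ∀ {x x′} → x ≢ x′ → ¬ SameEdge G (rung x) (rung x′)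
    rungs-apart x≢x′ (inj₁ refl) = x≢x′ refl
    rails-apart : ∀ {y y′} → y ≢ y′ → ¬ SameEdge G (rails y) (rails y′)
    rails-apart y≢y′ (inj₁ refl) = y≢y′ refl
    rung-rail-apart : ∀ {x y} → ¬ SameEdge G (rung x) (rails y)
    rung-rail-apart (inj₁ ())
    rung-rail-apart (inj₂ ())

  cut : Fin 2 → Edge G → Set
  cut fzero    = YCut 0
  cut (fsuc _) = XCut 0

  S₂-cuts : All (λ e → ∃ λ l → cut l e) S₂
  S₂-cuts = All.++⁺ (All.tabulate⁺ {f = rung} λ _ → fzero , inj₁ (refl , refl))
                    (All.tabulate⁺ {f = rails} λ _ → fsuc fzero , inj₁ (refl , refl))

  S₂-gp : IsEdgeGP G S₂
  S₂-gp = two-classes⇒EdgeGP cut one-per-cut S₂ S₂-distinct S₂-cuts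
    where
    one-per-cut : ∀ l → OnePerGeodesic (cut l)
    one-per-cut fzero    W geo = geodesic-YCut-unique W geo
    one-per-cut (fsuc _) W geo = geodesic-XCut-unique W geo

  horizontal? : (e : Edge G) → Dec (proj₂ (proj₁ e) ≡ proj₂ (proj₂ e))
  horizontal? e = proj₂ (proj₁ e) ≟ᶠ proj₂ (proj₂ e)

  weight : ∀ {P : Set} → Dec P → ℕ
  weight (yes _) = r
  weight (no _)  = 2

  Σweight : ∀ S → sum (map (weight ∘ horizontal?) S) ≡ r * count horizontal? S + 2 * count (¬? ∘ horizontal?) S
  Σweight []       = sym (cong₂ _+_ (*-zeroʳ r) refl)
  Σweight (e ∷ S) with horizontal? e
  ... | yes _ = trans (cong (r +_) (Σweight S))
                  (solve 3 (λ r h v → r :+ (r :* h :+ con 2 :* v) := r :* (con 1 :+ h) :+ con 2 :* v) refl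
                          r (count horizontal? S) (count (¬? ∘ horizontal?) S))
    where open +-*-Solver
  ... | no  _ = trans (cong (2 +_) (Σweight S))
                  (solve 3 (λ r h v → con 2 :+ (r :* h :+ con 2 :* v) := r :* h :+ con 2 :* (con 1 :+ v)) refl
                          r (count horizontal? S) (count (¬? ∘ horizontal?) S))
    where open +-*-Solver

  columns : List (GeodesicWalk G)
  columns = concatMap columnPair (allFin r)

  length-columns : length columns ≡ 2 * r
  length-columns = trans (length-concatMap columnPair (λ _ → refl) (allFin r))
                         (cong (2 *_) (length-tabulate {n = r} (λ x → x)))

  weight≤cover : ∀ e → Adj G (proj₁ e) (proj₂ e) → weight (horizontal? e) ≤ cover e columns
  weight≤cover e adj with grid-edge-cases e adj | horizontal? e
  ... | inj₁ (p , q , y , pq , e≈) | yes _ = ≤-trans (rails-covered y) (cover-resp columns (SameEdge-sym {G = G} e≈))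
    where
    rails-covered : ∀ y → r ≤ cover (hEdge p q y) columns
    rails-covered y = ≤-trans (≤-reflexive (sym (length-tabulate {n = r} (λ x → x))))
                        (length≤cover-concatMap _ columnPair (allFin r) (on-rail y))
      where
      on-rail : ∀ y x → 1 ≤ cover (hEdge p q y) (columnPair x)
      on-rail fzero        = bottom-on-columnPair pq
      on-rail (fsuc fzero) = top-on-columnPair pq
  ... | inj₁ (_ , _ , _ , _ , inj₁ refl) | no ¬h = ⊥-elim (¬h refl)
  ... | inj₁ (_ , _ , _ , _ , inj₂ refl) | no ¬h = ⊥-elim (¬h refl)
  ... | inj₂ (x , p , q , pq , inj₁ refl) | yes refl = ⊥-elim (1+n≢n pq)
  ... | inj₂ (x , p , q , pq , inj₂ refl) | yes refl = ⊥-elim (1+n≢n pq)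
  ... | inj₂ (x , p , q , pq , e≈) | no _ =
    ≤-trans (vEdge-on-columnPair pq x)
      (≤-trans (∈⇒cover≤cover-concatMap _ columnPair (∈-allFin x)) (cover-resp columns (SameEdge-sym {G = G} e≈)))

  rung-at : ∀ e → Adj G (proj₁ e) (proj₂ e) → ¬ (proj₂ (proj₁ e) ≡ proj₂ (proj₂ e)) →
            SameEdge G e (rung (proj₁ (proj₁ e)))
  rung-at e adj ¬h with grid-edge-cases e adj
  ... | inj₁ (_ , _ , _ , _ , inj₁ refl)              = ⊥-elim (¬h refl)
  ... | inj₁ (_ , _ , _ , _ , inj₂ refl)              = ⊥-elim (¬h refl)
  ... | inj₂ (_ , fzero , fsuc fzero , _ , inj₁ refl) = inj₁ refl
  ... | inj₂ (_ , fzero , fsuc fzero , _ , inj₂ refl) = inj₂ refl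
  ... | inj₂ (_ , fzero , fzero , () , _)
  ... | inj₂ (_ , fsuc fzero , fzero , () , _)
  ... | inj₂ (_ , fsuc fzero , fsuc fzero , () , _)

  rungs≤r : ∀ S → IsEdgeSet G S → count (¬? ∘ horizontal?) S ≤ r
  rungs≤r S (adj , distinct) = subst (_≤ r) (sym (count≡length-filter (¬? ∘ horizontal?) S)) (≮⇒≥ pigeon)
    where
    R : List (Edge G)
    R = filter (¬? ∘ horizontal?) S

    rung-of : ∀ i → SameEdge G (lookup R i) (rung (proj₁ (proj₁ (lookup R i))))
    rung-of i = rung-at _ (All.lookup (All.filter⁺ (¬? ∘ horizontal?) adj) (∈-lookup i))
                          (All.lookup (All.all-filter (¬? ∘ horizontal?) S) (∈-lookup i))

    pigeon : ¬ (r < length R)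
    pigeon r<R with pigeonhole r<R (λ i → proj₁ (proj₁ (lookup R i)))
    ... | i , j , i<j , same =
      AllPairs-lookup (λ ¬ab ba → ¬ab (SameEdge-sym {G = G} ba)) (AllPairs.filter⁺ (¬? ∘ horizontal?) distinct)
        (<⇒≢ᶠ i<j) (SameEdge-trans {G = G} (rung-of i)
                      (subst (λ x → SameEdge G (rung x) (lookup R j)) (sym same) (SameEdge-sym {G = G} (rung-of j))))

  S₂-upper : ∀ S → IsEdgeSet G S → IsEdgeGP G S → length S ≤ r + 2
  S₂-upper S es gp = begin
    length S ≡⟨ count+count-¬≡length horizontal? S ⟨
    #h + #v  ≤⟨ ladder-arithmetic r₂ #h #v weighted (rungs≤r S es) ⟩
    r + 2    ∎
    where
    open ≤-Reasoning
    #h #v : ℕ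
    #h = count horizontal? S
    #v = count (¬? ∘ horizontal?) S
    weighted : r * #h + 2 * #v ≤ 2 * (2 * r)
    weighted = begin
      r * #h + 2 * #v                       ≡⟨ Σweight S ⟨
      sum (map (weight ∘ horizontal?) S)    ≤⟨ weighted-cover-bound (weight ∘ horizontal?) columns weight≤cover S es gp ⟩
      2 * length columns                    ≡⟨ cong (2 *_) length-columns ⟩
      2 * (2 * r)                           ∎

  ladder-gpe : gpe≡ G (r + 2)
  ladder-gpe = (S₂ , (S₂-edges , S₂-distinct) , S₂-gp , length-S₂) , S₂-upper

interior : (n : ℕ) → List (Fin (suc (suc n)))
interior n = tabulate (λ i → fsuc (inject₁ i))

length-interior : ∀ n → length (interior n) ≡ n
length-interior n = length-tabulate (λ i → fsuc (inject₁ i))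

-- Three rows

module ThreeRowsCase (r₃ : ℕ) where

  open Staircases (suc (suc r₃)) 2

  r : ℕ
  r = suc (suc (suc r₃))

  lowerRung upperRung : Fin r → Edge G
  lowerRung x = vEdge x fzero (fsuc fzero)
  upperRung x = vEdge x (fsuc fzero) (fsuc (fsuc fzero))

  S₃ : List (Edge G)
  S₃ = tabulate lowerRung ++ tabulate upperRung

  length-S₃ : length S₃ ≡ 2 * r
  length-S₃ = trans (length-++ (tabulate lowerRung))
                    (trans (cong₂ _+_ (length-tabulate lowerRung) (length-tabulate upperRung))
                           (cong (r +_) (sym (+-identityʳ r))))

  S₃-edges : All (λ e → Adj G (proj₁ e) (proj₂ e)) S₃
  S₃-edges = All.++⁺ (All.tabulate⁺ {f = lowerRung} λ _ → inj₂ (refl , inj₁ refl))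
                     (All.tabulate⁺ {f = upperRung} λ _ → inj₂ (refl , inj₁ refl))

  S₃-distinct : AllPairs (λ e f → ¬ SameEdge G e f) S₃
  S₃-distinct = AllPairs.++⁺ (AllPairs.tabulate⁺ {f = lowerRung} lower-apart)
                             (AllPairs.tabulate⁺ {f = upperRung} upper-apart)
                             (All.tabulate⁺ {f = lowerRung} λ _ → All.tabulate⁺ {f = upperRung} λ _ → lower-upper-apart)
    where
    lower-apart : ∀ {x x′} → x ≢ x′ → ¬ SameEdge G (lowerRung x) (lowerRung x′)
    lower-apart x≢x′ (inj₁ refl) = x≢x′ refl
    upper-apart : ∀ {x x′} → x ≢ x′ → ¬ SameEdge G (upperRung x) (upperRung x′)
    upper-apart x≢x′ (inj₁ refl) = x≢x′ refl
    lower-upper-apart : ∀ {x x′} → ¬ SameEdge G (lowerRung x) (upperRung x′)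
    lower-upper-apart (inj₁ ())
    lower-upper-apart (inj₂ ())

  cut : Fin 2 → Edge G → Set
  cut fzero    = YCut 0
  cut (fsuc _) = YCut 1

  S₃-gp : IsEdgeGP G S₃
  S₃-gp = two-classes⇒EdgeGP cut one-per-cut S₃ S₃-distinct
            (All.++⁺ (All.tabulate⁺ {f = lowerRung} λ _ → fzero , inj₁ (refl , refl))
                     (All.tabulate⁺ {f = upperRung} λ _ → fsuc fzero , inj₁ (refl , refl)))
    where
    one-per-cut : ∀ l → OnePerGeodesic (cut l)
    one-per-cut fzero    W geo = geodesic-YCut-unique W geo
    one-per-cut (fsuc _) W geo = geodesic-YCut-unique W geo

  middleRow corners columns : List (GeodesicWalk G)
  middleRow = rowPair (fsuc fzero)
  columns   = concatMap columnPair (interior (suc r₃))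
  corners   = column↗ fzero ∷ column↗ right ∷ []

  Gs₃ : List (GeodesicWalk G)
  Gs₃ = middleRow ++ columns ++ corners

  length-Gs₃ : length Gs₃ ≡ 2 * r
  length-Gs₃ = begin
    length (middleRow ++ columns ++ corners) ≡⟨ length-++ middleRow {columns ++ corners} ⟩
    2 + length (columns ++ corners)          ≡⟨ cong (2 +_) (length-++ columns {corners}) ⟩
    2 + (length columns + 2)                 ≡⟨ cong (λ n → 2 + (n + 2))
                                                     (length-concatMap columnPair (λ _ → refl) (interior (suc r₃))) ⟩
    2 + (2 * length (interior (suc r₃)) + 2) ≡⟨ cong (λ n → 2 + (2 * n + 2)) (length-interior (suc r₃)) ⟩
    2 + (2 * suc r₃ + 2)                     ≡⟨ solve 1 (λ n → con 2 :+ (con 2 :* (con 1 :+ n) :+ con 2)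
                                                           := con 2 :* (con 3 :+ n)) refl r₃ ⟩
    2 * r                                    ∎
    where
    open ≡-Reasoning
    open +-*-Solver

  interior-nonempty : ∀ e → (∀ x → 1 ≤ cover e (columnPair x)) → 1 ≤ cover e columns
  interior-nonempty e covered =
    ≤-trans (≤-trans (s≤s z≤n) (≤-reflexive (sym (length-interior (suc r₃)))))
            (length≤cover-concatMap e columnPair (interior (suc r₃)) covered)

  covered-twice : ∀ e → Adj G (proj₁ e) (proj₂ e) → 2 ≤ cover e Gs₃
  covered-twice = every-edge-covered Gs₃ horizontal-covered vertical-covered
    where
    horizontal-covered : ∀ {p q} y → suc (toℕ p) ≡ toℕ q → 2 ≤ cover (hEdge p q y) Gs₃
    horizontal-covered {p} {q} fzero pq =
      cover-++-≤ e middleRow (columns ++ corners) z≤n (cover-++-≤ e columns corners (interior-nonempty e (bottom-on-columnPair pq))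
        (cover-pair-either (column↗ fzero) (column↗ right) (inj₂ (bottom-on-column↗-right pq))))
      where
      e : Edge G
      e = hEdge p q fzero
    horizontal-covered {p} {q} (fsuc fzero) pq =
      cover-++-≤ (hEdge p q (fsuc fzero)) middleRow (columns ++ corners) (hEdge-on-rowPair pq (fsuc fzero)) z≤n
    horizontal-covered {p} {q} (fsuc (fsuc fzero)) pq =
      cover-++-≤ e middleRow (columns ++ corners) z≤n (cover-++-≤ e columns corners (interior-nonempty e (top-on-columnPair pq))
        (cover-pair-either (column↗ fzero) (column↗ right) (inj₁ (top-on-column↗-left pq))))
      where
      e : Edge G
      e = hEdge p q top

    vertical-covered : ∀ x {p q} → suc (toℕ p) ≡ toℕ q → 2 ≤ cover (vEdge x p q) Gs₃
    vertical-covered fzero {p} {q} pq =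
      cover-++-≤ e middleRow (columns ++ corners) (left-on-rowPair pq (fsuc fzero)) (cover-++-≤ e columns corners z≤n
        (cover-pair-either (column↗ fzero) (column↗ right) (inj₁ (vEdge-on-column↗ pq fzero))))
      where
      e : Edge G
      e = vEdge fzero p q
    vertical-covered (fsuc x) {p} {q} pq with view x
    ... | ‵fromℕ          =
      cover-++-≤ e middleRow (columns ++ corners) (right-on-rowPair pq (fsuc fzero)) (cover-++-≤ e columns corners z≤n
        (cover-pair-either (column↗ fzero) (column↗ right) (inj₂ (vEdge-on-column↗ pq right))))
      where
      e : Edge G
      e = vEdge right p q
    ... | ‵inj₁ {i = i} _ =
      cover-++-≤ e middleRow (columns ++ corners) z≤n (cover-++-≤ e columns corners
        (≤-trans (vEdge-on-columnPair pq x′) (∈⇒cover≤cover-concatMap e columnPair (∈-tabulate⁺ {f = λ i → fsuc (inject₁ i)} i))) z≤n)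
      where
      x′ : Fin r
      x′ = fsuc (inject₁ i)
      e : Edge G
      e = vEdge x′ p q

  three-rows-gpe : gpe≡ G (2 * r)
  three-rows-gpe = (S₃ , (S₃-edges , S₃-distinct) , S₃-gp , length-S₃) ,
                   λ S es gp → ≤-trans (double-cover-bound Gs₃ covered-twice S es gp) (≤-reflexive length-Gs₃)

-- At least four rows

interior-bounds : ∀ {n} (i : Fin n) → 1 ≤ toℕ {suc (suc n)} (fsuc (inject₁ i)) × toℕ {suc (suc n)} (fsuc (inject₁ i)) ≤ n
interior-bounds i = s≤s z≤n , ≤-trans (s≤s (≤-reflexive (toℕ-inject₁ i))) (toℕ<n i)

m+m-injective : ∀ m n → m + m ≡ n + n → m ≡ n
m+m-injective m n eq = *-cancelˡ-≡ m n 2 (trans (cong (m +_) (+-identityʳ m)) (trans eq (sym (cong (n +_) (+-identityʳ n)))))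

1≢m+n : ∀ {m n} → 1 ≤ m → 1 ≤ n → 1 ≢ m + n
1≢m+n 1≤m 1≤n eq = <-irrefl eq (+-mono-≤ 1≤m 1≤n)

m+m≢n+1+n : ∀ {m n} → m ≤ n → m + m ≢ n + suc n
m+m≢n+1+n {m} {n} m≤n eq = <-irrefl eq (≤-<-trans (+-mono-≤ m≤n m≤n) (+-monoʳ-< n (n<1+n n)))

module FrameCase (r₂ s₂ : ℕ) (2≤s₂ : 2 ≤ s₂) (s₂≤r₂ : s₂ ≤ r₂) where

  open Staircases (suc r₂) (suc s₂)

  r s : ℕ
  r = suc (suc r₂)
  s = suc (suc s₂)

  frame-size : 2 * r₂ + 2 * s₂ ≡ 2 * r + 2 * s ∸ 8
  frame-size = trans (sym (m+n∸n≡m (2 * r₂ + 2 * s₂) 8)) (cong (_∸ 8)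
    (solve 2 (λ r s → con 2 :* r :+ con 2 :* s :+ con 8 := con 2 :* (con 2 :+ r) :+ con 2 :* (con 2 :+ s)) refl r₂ s₂))
    where open +-*-Solver

  InteriorRow InteriorColumn : Fin r × Fin s → Set
  InteriorRow v    = 1 ≤ Y v × Y v ≤ s₂
  InteriorColumn v = 1 ≤ X v × X v ≤ r₂

  Left Right Bottom Top : Edge G → Set
  Left   e = XCut 0 e  × X (proj₁ e) ≡ 0      × InteriorRow (proj₁ e)
  Right  e = XCut r₂ e × X (proj₂ e) ≡ suc r₂ × InteriorRow (proj₂ e)
  Bottom e = YCut 0 e  × Y (proj₁ e) ≡ 0      × InteriorColumn (proj₁ e)
  Top    e = YCut s₂ e × Y (proj₂ e) ≡ suc s₂ × InteriorColumn (proj₂ e)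

  side : Fin 4 → Edge G → Set
  side fzero                      = Left
  side (fsuc fzero)               = Right
  side (fsuc (fsuc fzero))        = Bottom
  side (fsuc (fsuc (fsuc fzero))) = Top

  one-per-side : ∀ l → OnePerGeodesic {G = G} (side l)
  one-per-side fzero                      W geo on on′ e f = geodesic-XCut-unique W geo on on′ (proj₁ e) (proj₁ f)
  one-per-side (fsuc fzero)               W geo on on′ e f = geodesic-XCut-unique W geo on on′ (proj₁ e) (proj₁ f)
  one-per-side (fsuc (fsuc fzero))        W geo on on′ e f = geodesic-YCut-unique W geo on on′ (proj₁ e) (proj₁ f)
  one-per-side (fsuc (fsuc (fsuc fzero))) W geo on on′ e f = geodesic-YCut-unique W geo on on′ (proj₁ e) (proj₁ f)

  module _ {u v} (W : Walk G u v) (geo : Geodesic G W) where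

    left-right-confines : ∀ {eₗ eᵣ} → EdgeOn G eₗ W → EdgeOn G eᵣ W → Left eₗ → Right eᵣ →
                          ∀ k → InteriorColumn (vertexAt W k) → InteriorRow (vertexAt W k)
    left-right-confines onₗ onᵣ (_ , x≡0 , 1≤y , y≤) (_ , x≡ , 1≤y′ , y′≤) k (1≤x , x≤)
      with EdgeOn⇒visits W onₗ | EdgeOn⇒visits W onᵣ
    ... | a , _ , refl , _ | _ , c , _ , refl =
      Between-bounded (geodesic-Between-Y W geo {a} {k} {c} (subst (_< X (vertexAt W k)) (sym x≡0) 1≤x)
                                                           (subst (X (vertexAt W k) <_) (sym x≡) (s≤s x≤)))
                      1≤y y≤ 1≤y′ y′≤

    bottom-top-confines : ∀ {e_b e_t} → EdgeOn G e_b W → EdgeOn G e_t W → Bottom e_b → Top e_t →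
                          ∀ k → InteriorRow (vertexAt W k) → InteriorColumn (vertexAt W k)
    bottom-top-confines on_b on_t (_ , y≡0 , 1≤x , x≤) (_ , y≡ , 1≤x′ , x′≤) k (1≤y , y≤)
      with EdgeOn⇒visits W on_b | EdgeOn⇒visits W on_t
    ... | a , _ , refl , _ | _ , c , _ , refl =
      Between-bounded (geodesic-Between-X W geo {a} {k} {c} (subst (_< Y (vertexAt W k)) (sym y≡0) 1≤y)
                                                           (subst (Y (vertexAt W k) <_) (sym y≡) (s≤s y≤)))
                      1≤x x≤ 1≤x′ x′≤

  no-left-right-bottom : NoCommonGeodesic {G = G} Left Right Bottom
  no-left-right-bottom W geo onₗ onᵣ on_b ℓ ρ (_ , y≡0 , interior-column) with EdgeOn⇒visits W on_b
  ... | b , _ , refl , _ = 1+n≰n (subst (1 ≤_) y≡0 (proj₁ (left-right-confines W geo onₗ onᵣ ℓ ρ b interior-column)))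

  no-left-right-top : NoCommonGeodesic {G = G} Left Right Top
  no-left-right-top W geo onₗ onᵣ on_t ℓ ρ (_ , y≡ , interior-column) with EdgeOn⇒visits W on_t
  ... | _ , t , _ , refl = 1+n≰n (subst (_≤ s₂) y≡ (proj₂ (left-right-confines W geo onₗ onᵣ ℓ ρ t interior-column)))

  no-left-bottom-top : NoCommonGeodesic {G = G} Left Bottom Top
  no-left-bottom-top W geo onₗ on_b on_t (_ , x≡0 , interior-row) β τ with EdgeOn⇒visits W onₗ
  ... | l , _ , refl , _ = 1+n≰n (subst (1 ≤_) x≡0 (proj₁ (bottom-top-confines W geo on_b on_t β τ l interior-row)))

  no-right-bottom-top : NoCommonGeodesic {G = G} Right Bottom Top
  no-right-bottom-top W geo onᵣ on_b on_t (_ , x≡ , interior-row) β τ with EdgeOn⇒visits W onᵣ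
  ... | _ , k , _ , refl = 1+n≰n (subst (_≤ r₂) x≡ (proj₂ (bottom-top-confines W geo on_b on_t β τ k interior-row)))

  no-three-sides : ∀ {l₁ l₂ l₃ : Fin 4} → l₁ <ᶠ l₂ → l₂ <ᶠ l₃ → NoCommonGeodesic {G = G} (side l₁) (side l₂) (side l₃)
  no-three-sides {fzero}      {fsuc fzero}        {fsuc (fsuc fzero)}        _ _ = no-left-right-bottom
  no-three-sides {fzero}      {fsuc fzero}        {fsuc (fsuc (fsuc fzero))} _ _ = no-left-right-top
  no-three-sides {fzero}      {fsuc (fsuc fzero)} {fsuc (fsuc (fsuc fzero))} _ _ = no-left-bottom-top
  no-three-sides {fsuc fzero} {fsuc (fsuc fzero)} {fsuc (fsuc (fsuc fzero))} _ _ = no-right-bottom-top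
  no-three-sides {l₂ = fzero} ()
  no-three-sides {l₃ = fzero} _ ()
  no-three-sides {fsuc _} {fsuc fzero} (s≤s ())
  no-three-sides {fsuc (fsuc _)} {fsuc (fsuc fzero)} (s≤s (s≤s ()))
  no-three-sides {l₂ = fsuc fzero} {fsuc fzero} _ (s≤s ())
  no-three-sides {l₂ = fsuc (fsuc fzero)} {fsuc fzero} _ (s≤s ())
  no-three-sides {l₂ = fsuc (fsuc fzero)} {fsuc (fsuc fzero)} _ (s≤s (s≤s ()))
  no-three-sides {l₂ = fsuc (fsuc (fsuc fzero))} {l₃} _ l₂<l₃ = ⊥-elim (<⇒≱ l₂<l₃ (toℕ≤pred[n] l₃))

  row : Fin s₂ → Fin s
  row i = fsuc (inject₁ i)

  column : Fin r₂ → Fin r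
  column j = fsuc (inject₁ j)

  penultimate-column : Fin r
  penultimate-column = inject₁ (fromℕ r₂)

  penultimate-row : Fin s
  penultimate-row = inject₁ (fromℕ s₂)

  leftEdge rightEdge : Fin s₂ → Edge G
  leftEdge  i = hEdge fzero (fsuc fzero) (row i)
  rightEdge i = hEdge penultimate-column right (row i)

  bottomEdge topEdge : Fin r₂ → Edge G
  bottomEdge j = vEdge (column j) fzero (fsuc fzero)
  topEdge    j = vEdge (column j) penultimate-row top

  S₄ : List (Edge G)
  S₄ = tabulate leftEdge ++ tabulate rightEdge ++ tabulate bottomEdge ++ tabulate topEdge

  length-S₄ : length S₄ ≡ 2 * r + 2 * s ∸ 8
  length-S₄ = begin
    length S₄                                  ≡⟨ length-++ (tabulate leftEdge) ⟩
    length (tabulate leftEdge) + length (tabulate rightEdge ++ tabulate bottomEdge ++ tabulate topEdge)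
      ≡⟨ cong (length (tabulate leftEdge) +_) (trans (length-++ (tabulate rightEdge))
                                                     (cong (length (tabulate rightEdge) +_) (length-++ (tabulate bottomEdge)))) ⟩
    length (tabulate leftEdge) + (length (tabulate rightEdge) + (length (tabulate bottomEdge) + length (tabulate topEdge)))
      ≡⟨ cong₂ _+_ (length-tabulate leftEdge) (cong₂ _+_ (length-tabulate rightEdge)
                                                       (cong₂ _+_ (length-tabulate bottomEdge) (length-tabulate topEdge))) ⟩
    s₂ + (s₂ + (r₂ + r₂))                      ≡⟨ solve 2 (λ r s → s :+ (s :+ (r :+ r)) := con 2 :* r :+ con 2 :* s) refl r₂ s₂ ⟩
    2 * r₂ + 2 * s₂                            ≡⟨ frame-size ⟩
    2 * r + 2 * s ∸ 8                          ∎
    where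
    open ≡-Reasoning
    open +-*-Solver

  private
    toℕ-penultimate-column : toℕ penultimate-column ≡ r₂
    toℕ-penultimate-column = trans (toℕ-inject₁ (fromℕ r₂)) (toℕ-fromℕ r₂)

    toℕ-penultimate-row : toℕ penultimate-row ≡ s₂
    toℕ-penultimate-row = trans (toℕ-inject₁ (fromℕ s₂)) (toℕ-fromℕ s₂)

    toℕ-right : toℕ right ≡ suc r₂
    toℕ-right = toℕ-fromℕ (suc r₂)

    toℕ-top : toℕ top ≡ suc s₂
    toℕ-top = toℕ-fromℕ (suc s₂)

    2≤r₂ : 2 ≤ r₂
    2≤r₂ = ≤-trans 2≤s₂ s₂≤r₂

    1≤r₂ : 1 ≤ r₂
    1≤r₂ = ≤-trans (s≤s z≤n) 2≤r₂

    1≤s₂ : 1 ≤ s₂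
    1≤s₂ = ≤-trans (s≤s z≤n) 2≤s₂

  S₄-edges : All (λ e → Adj G (proj₁ e) (proj₂ e)) S₄
  S₄-edges =
    All.++⁺ (All.tabulate⁺ {f = leftEdge} λ _ → inj₁ (inj₁ refl , refl))
    (All.++⁺ (All.tabulate⁺ {f = rightEdge} λ _ → inj₁ (inj₁ (trans (cong suc toℕ-penultimate-column) (sym toℕ-right)) , refl))
    (All.++⁺ (All.tabulate⁺ {f = bottomEdge} λ _ → inj₂ (refl , inj₁ refl))
             (All.tabulate⁺ {f = topEdge} λ _ → inj₂ (refl , inj₁ (trans (cong suc toℕ-penultimate-row) (sym toℕ-top))))))

  S₄-sides : All (λ e → ∃ λ l → side l e) S₄
  S₄-sides =
    All.++⁺ (All.tabulate⁺ {f = leftEdge} λ i → fzero , inj₁ (refl , refl) , refl , interior-bounds i)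
    (All.++⁺ (All.tabulate⁺ {f = rightEdge} λ i →
                fsuc fzero , inj₁ (toℕ-penultimate-column , toℕ-right) , toℕ-right , interior-bounds i)
    (All.++⁺ (All.tabulate⁺ {f = bottomEdge} λ j → fsuc (fsuc fzero) , inj₁ (refl , refl) , refl , interior-bounds j)
             (All.tabulate⁺ {f = topEdge} λ j →
                fsuc (fsuc (fsuc fzero)) , inj₁ (toℕ-penultimate-row , toℕ-top) , toℕ-top , interior-bounds j)))

  -- An edge is determined by the sum of its endpoints.
  doubled-midpoint : Edge G → ℕ × ℕ
  doubled-midpoint (u , v) = X u + X v , Y u + Y v

  private
    doubled-midpoint-resp : ∀ {e f} → SameEdge G e f → doubled-midpoint e ≡ doubled-midpoint f
    doubled-midpoint-resp (inj₁ refl)            = refl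
    doubled-midpoint-resp {e = u , v} (inj₂ refl) = cong₂ _,_ (+-comm (X u) (X v)) (+-comm (Y u) (Y v))

    apartˣ : ∀ {e f} → proj₁ (doubled-midpoint e) ≢ proj₁ (doubled-midpoint f) → ¬ SameEdge G e f
    apartˣ ne e≈f = ne (cong proj₁ (doubled-midpoint-resp e≈f))

    apartʸ : ∀ {e f} → proj₂ (doubled-midpoint e) ≢ proj₂ (doubled-midpoint f) → ¬ SameEdge G e f
    apartʸ ne e≈f = ne (cong proj₂ (doubled-midpoint-resp e≈f))

    interior-injective : ∀ {n} {i j : Fin n} → i ≢ j →
                         toℕ {suc (suc n)} (fsuc (inject₁ i)) + toℕ (fsuc (inject₁ i))
                           ≢ toℕ {suc (suc n)} (fsuc (inject₁ j)) + toℕ (fsuc (inject₁ j))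
    interior-injective i≢j eq = i≢j (inject₁-injective (fsuc-injective (toℕ-injective (m+m-injective _ _ eq))))

    1≤penultimate-column : 1 ≤ toℕ penultimate-column
    1≤penultimate-column = subst (1 ≤_) (sym toℕ-penultimate-column) 1≤r₂

    1≤penultimate-row : 1 ≤ toℕ penultimate-row
    1≤penultimate-row = subst (1 ≤_) (sym toℕ-penultimate-row) 1≤s₂

    left-right : ∀ i i′ → ¬ SameEdge G (leftEdge i) (rightEdge i′)
    left-right _ _ = apartˣ (1≢m+n 1≤penultimate-column (subst (1 ≤_) (sym toℕ-right) (s≤s z≤n)))

    left-bottom : ∀ i j → ¬ SameEdge G (leftEdge i) (bottomEdge j)
    left-bottom i _ = apartʸ (≢-sym (1≢m+n (proj₁ (interior-bounds i)) (proj₁ (interior-bounds i))))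

    left-top : ∀ i j → ¬ SameEdge G (leftEdge i) (topEdge j)
    left-top _ j = apartˣ (1≢m+n (proj₁ (interior-bounds j)) (proj₁ (interior-bounds j)))

    right-bottom : ∀ i j → ¬ SameEdge G (rightEdge i) (bottomEdge j)
    right-bottom i _ = apartʸ (≢-sym (1≢m+n (proj₁ (interior-bounds i)) (proj₁ (interior-bounds i))))

    right-top : ∀ i j → ¬ SameEdge G (rightEdge i) (topEdge j)
    right-top _ j = apartˣ λ eq →
      m+m≢n+1+n (proj₂ (interior-bounds j)) (trans (sym eq) (cong₂ _+_ toℕ-penultimate-column toℕ-right))

    bottom-top : ∀ j j′ → ¬ SameEdge G (bottomEdge j) (topEdge j′)
    bottom-top _ _ = apartʸ (1≢m+n 1≤penultimate-row (subst (1 ≤_) (sym toℕ-top) (s≤s z≤n)))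

  S₄-distinct : AllPairs (λ e f → ¬ SameEdge G e f) S₄
  S₄-distinct =
    AllPairs.++⁺ (AllPairs.tabulate⁺ {f = leftEdge} (apartʸ ∘ interior-injective))
    (AllPairs.++⁺ (AllPairs.tabulate⁺ {f = rightEdge} (apartʸ ∘ interior-injective))
      (AllPairs.++⁺ (AllPairs.tabulate⁺ {f = bottomEdge} (apartˣ ∘ interior-injective))
                    (AllPairs.tabulate⁺ {f = topEdge} (apartˣ ∘ interior-injective))
                    (cross bottomEdge topEdge bottom-top))
      (All.tabulate⁺ {f = rightEdge} λ i → All.++⁺ (cross₁ (rightEdge i) bottomEdge (right-bottom i))
                                                   (cross₁ (rightEdge i) topEdge (right-top i))))
    (All.tabulate⁺ {f = leftEdge} λ i → All.++⁺ (cross₁ (leftEdge i) rightEdge (left-right i))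
                         (All.++⁺ (cross₁ (leftEdge i) bottomEdge (left-bottom i)) (cross₁ (leftEdge i) topEdge (left-top i))))
    where
    cross₁ : ∀ {n} e (g : Fin n → Edge G) → (∀ j → ¬ SameEdge G e (g j)) → All (λ f → ¬ SameEdge G e f) (tabulate g)
    cross₁ e g apart = All.tabulate⁺ {f = g} apart
    cross : ∀ {m n} (f : Fin m → Edge G) (g : Fin n → Edge G) → (∀ i j → ¬ SameEdge G (f i) (g j)) →
            All (λ e → All (λ e′ → ¬ SameEdge G e e′) (tabulate g)) (tabulate f)
    cross f g apart = All.tabulate⁺ {f = f} λ i → cross₁ (f i) g (apart i)

  S₄-gp : IsEdgeGP G S₄
  S₄-gp = classes⇒EdgeGP side one-per-side no-three-sides S₄ S₄-distinct S₄-sides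

  rows columns Gs₄ : List (GeodesicWalk G)
  rows    = concatMap rowPair (interior s₂)
  columns = concatMap columnPair (interior r₂)
  Gs₄     = rows ++ columns

  length-Gs₄ : length Gs₄ ≡ 2 * r + 2 * s ∸ 8
  length-Gs₄ = begin
    length (rows ++ columns)                    ≡⟨ length-++ rows {columns} ⟩
    length rows + length columns                ≡⟨ cong₂ _+_ (length-concatMap rowPair (λ _ → refl) (interior s₂))
                                                             (length-concatMap columnPair (λ _ → refl) (interior r₂)) ⟩
    2 * length (interior s₂) + 2 * length (interior r₂)
                                                ≡⟨ cong₂ (λ m n → 2 * m + 2 * n) (length-interior s₂) (length-interior r₂) ⟩
    2 * s₂ + 2 * r₂                             ≡⟨ +-comm (2 * s₂) (2 * r₂) ⟩
    2 * r₂ + 2 * s₂                             ≡⟨ frame-size ⟩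
    2 * r + 2 * s ∸ 8                           ∎
    where open ≡-Reasoning

  private
    two-interior : ∀ {n} → 2 ≤ n → 2 ≤ length (interior n)
    two-interior {n} 2≤n = subst (2 ≤_) (sym (length-interior n)) 2≤n

  covered-twice : ∀ e → Adj G (proj₁ e) (proj₂ e) → 2 ≤ cover e Gs₄
  covered-twice = every-edge-covered Gs₄ horizontal-covered vertical-covered
    where
    horizontal-covered : ∀ {p q} y → suc (toℕ p) ≡ toℕ q → 2 ≤ cover (hEdge p q y) Gs₄
    horizontal-covered {p} {q} fzero pq = cover-++-≤ e rows columns z≤n
      (≤-trans (two-interior 2≤r₂) (length≤cover-concatMap e columnPair (interior r₂) (bottom-on-columnPair pq)))
      where
      e : Edge G
      e = hEdge p q fzero
    horizontal-covered {p} {q} (fsuc y) pq with view y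
    ... | ‵fromℕ          = cover-++-≤ e rows columns z≤n
      (≤-trans (two-interior 2≤r₂) (length≤cover-concatMap e columnPair (interior r₂) (top-on-columnPair pq)))
      where
      e : Edge G
      e = hEdge p q top
    ... | ‵inj₁ {i = i} _ = cover-++-≤ e rows columns
      (≤-trans (hEdge-on-rowPair pq (row i)) (∈⇒cover≤cover-concatMap e rowPair (∈-tabulate⁺ {f = row} i))) z≤n
      where
      e : Edge G
      e = hEdge p q (row i)

    vertical-covered : ∀ x {p q} → suc (toℕ p) ≡ toℕ q → 2 ≤ cover (vEdge x p q) Gs₄
    vertical-covered fzero {p} {q} pq = cover-++-≤ e rows columns
      (≤-trans (two-interior 2≤s₂) (length≤cover-concatMap e rowPair (interior s₂) (left-on-rowPair pq))) z≤n
      where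
      e : Edge G
      e = vEdge fzero p q
    vertical-covered (fsuc x) {p} {q} pq with view x
    ... | ‵fromℕ          = cover-++-≤ e rows columns
      (≤-trans (two-interior 2≤s₂) (length≤cover-concatMap e rowPair (interior s₂) (right-on-rowPair pq))) z≤n
      where
      e : Edge G
      e = vEdge right p q
    ... | ‵inj₁ {i = j} _ = cover-++-≤ e rows columns z≤n
      (≤-trans (vEdge-on-columnPair pq (column j)) (∈⇒cover≤cover-concatMap e columnPair (∈-tabulate⁺ {f = column} j)))
      where
      e : Edge G
      e = vEdge (column j) p q

  frame-gpe : gpe≡ G (2 * r + 2 * s ∸ 8)
  frame-gpe = (S₄ , (S₄-edges , S₄-distinct) , S₄-gp , length-S₄) ,
              λ S es gp → ≤-trans (double-cover-bound Gs₄ covered-twice S es gp) (≤-reflexive length-Gs₄)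

gpe-ladder : ∀ r → 2 ≤ r → gpe≡ (P r □ P 2) (r + 2)
gpe-ladder (suc (suc r₂)) _         = LadderCase.ladder-gpe r₂
gpe-ladder (suc zero)     (s≤s ())

gpe-three-rows : ∀ r → 3 ≤ r → gpe≡ (P r □ P 3) (2 * r)
gpe-three-rows (suc (suc (suc r₃))) _               = ThreeRowsCase.three-rows-gpe r₃
gpe-three-rows (suc zero)           (s≤s ())
gpe-three-rows (suc (suc zero))     (s≤s (s≤s ()))

gpe-frame : ∀ r s → 4 ≤ s → s ≤ r → gpe≡ (P r □ P s) (2 * r + 2 * s ∸ 8)
gpe-frame (suc (suc r₂)) (suc (suc s₂)) (s≤s (s≤s 2≤s₂)) (s≤s (s≤s s₂≤r₂)) = FrameCase.frame-gpe r₂ s₂ 2≤s₂ s₂≤r₂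

theorem4p1 : ∀ (r s : ℕ) → 2 ≤ s → s ≤ r →
    (s ≡ 2 → gpe≡ (P r □ P s) (r + 2))
    × (s ≡ 3 → gpe≡ (P r □ P s) (2 * r))
    × (4 ≤ s → gpe≡ (P r □ P s) (2 * r + 2 * s ∸ 8))
theorem4p1 r s _ s≤r = (λ { refl → gpe-ladder r s≤r }) , (λ { refl → gpe-three-rows r s≤r }) , λ 4≤s → gpe-frame r s 4≤s s≤r
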